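{- Let $G$ be a star cactus with at least two blocks. Then $G$ is ${\cal N}$ for the Maker-Breaker total domination game if and only if all cycles of $G$ have length at most $5$ and $G$ contains at least one of the following: a $3$-cycle, a $4$-cycle, or two blocks isomorphic to $K_2$. Otherwise $G$ is ${\cal S}$.
   Context: The Maker-Breaker total domination game on a graph is played by Dominator and Staller, who alternately select a vertex not selected before. Dominator wins if at some point the set of vertices he has selected is a total dominating set (every vertex has a neighbour in it); otherwise Staller wins. A graph is ${\cal S}$ if Staller has a winning strategy both when she moves first and when Dominator moves first, and ${\cal N}$ if the first player has a winning strategy (Dominator wins when he starts, Staller wins when she starts). A cactus is a connected graph whose blocks are all cycles or $K_2$; a star cactus is a cactus containing a vertex that lies in every block. -}

module Defs where

open import Data.Nat using (ℕ; zero; suc; _≤_; _∸_)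
open import Data.Fin using (Fin; toℕ)
open import Data.Fin.Subset using (Subset; _∈_; _∉_; _∪_; ⁅_⁆; ⊥)
open import Data.Product using (Σ; ∃; ∃-syntax; _×_; _,_)
open import Data.Sum using (_⊎_)
open import Relation.Nullary using (¬_)
open import Relation.Binary.PropositionalEquality using (_≡_; _≢_)
open import Function.Definitions using (Injective)

record Graph : Set₁ where
  field
    n      : ℕ
    _~_    : Fin n → Fin n → Set
    sym    : ∀ {u v} → u ~ v → v ~ u
    irrefl : ∀ {u} → ¬ (u ~ u)
open Graph public

IsTotalDominating : (G : Graph) → Subset (n G) → Set
IsTotalDominating G D = ∀ v → ∃[ u ] (u ∈ D × _~_ G v u)

-- Maker-Breaker total domination game
-- A position: D = vertices chosen by Dominator, S = vertices chosen by
-- Staller, and whose turn it is.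

data Player : Set where
  dominator staller : Player

Free : ∀ {m} → Subset m → Subset m → Fin m → Set
Free D S v = v ∉ D × v ∉ S

data DomWins (G : Graph) : Subset (n G) → Subset (n G) → Player → Set where
  dom-done  : ∀ {D S p} → IsTotalDominating G D → DomWins G D S p
  dom-move  : ∀ {D S} (v : Fin (n G)) → Free D S v →
              DomWins G (D ∪ ⁅ v ⁆) S staller → DomWins G D S dominator
  stal-move : ∀ {D S} → (∃[ v ] Free D S v) →
              (∀ v → Free D S v → DomWins G D (S ∪ ⁅ v ⁆) dominator) →
              DomWins G D S staller

data StalWins (G : Graph) : Subset (n G) → Subset (n G) → Player → Set where
  stal-done : ∀ {D S p} → ¬ IsTotalDominating G D →
              (∀ v → ¬ Free D S v) → StalWins G D S p
  stal-move : ∀ {D S} → ¬ IsTotalDominating G D → (v : Fin (n G)) → Free D S v →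
              StalWins G D (S ∪ ⁅ v ⁆) dominator → StalWins G D S staller
  dom-move  : ∀ {D S} → ¬ IsTotalDominating G D →
              (∀ v → Free D S v → StalWins G (D ∪ ⁅ v ⁆) S staller) →
              StalWins G D S dominator

-- Outcome classes.  (Dominator wins as first player iff he wins from the
-- empty position with Dominator to move, etc.)
IsN : Graph → Set
IsN G = DomWins G ⊥ ⊥ dominator × StalWins G ⊥ ⊥ staller

IsS : Graph → Set
IsS G = StalWins G ⊥ ⊥ dominator × StalWins G ⊥ ⊥ staller

CycStep : (m : ℕ) → Fin m → Fin m → Set
CycStep m i j = (toℕ j ≡ suc (toℕ i)) ⊎ (toℕ i ≡ m ∸ 1 × toℕ j ≡ 0)

CycAdj : (m : ℕ) → Fin m → Fin m → Set
CycAdj m i j = CycStep m i j ⊎ CycStep m j i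

IsCycle : (G : Graph) (m : ℕ) → (Fin m → Fin (n G)) → Set
IsCycle G m f = 3 ≤ m × Injective _≡_ _≡_ f ×
                (∀ i j → CycAdj m i j → _~_ G (f i) (f j))

HasCycleOfLength : Graph → ℕ → Set
HasCycleOfLength G m = Σ (Fin m → Fin (n G)) (IsCycle G m)

AllCyclesAtMost : Graph → ℕ → Set
AllCyclesAtMost G k = ∀ m (f : Fin m → Fin (n G)) → IsCycle G m f → m ≤ k

-- Star cacti, given together with their block decomposition.
-- A block on vertices w 0, …, w (len-1) (distinct), with w 0 the centre:
-- len = 2 means the block is K₂ (the edge w0 w1); len ≥ 3 means it is
-- the cycle w0 w1 … w(len-1) w0.

record Block (N : ℕ) : Set where
  field
    extra : ℕ
    verts : Fin (suc (suc extra)) → Fin N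
  len : ℕ
  len = suc (suc extra)
open Block public

InBlock : ∀ {N} → Block N → Fin N → Set
InBlock b v = ∃[ i ] verts b i ≡ v

BlockEdge : ∀ {N} → Block N → Fin N → Fin N → Set
BlockEdge b x y = ∃[ i ] ∃[ j ] (CycAdj (len b) i j × verts b i ≡ x × verts b j ≡ y)

IsK₂Block : ∀ {N} → Block N → Set
IsK₂Block b = len b ≡ 2

-- G is a star cactus with centre `centre` and blocks `blocks 0..k-1`:
-- each block is a K₂ or a cycle through the centre, the blocks
-- pairwise share only the centre, their edges are exactly the edges of G,
-- and every vertex lies in some block (so G is connected).  Such blocks are
-- then exactly the blocks (maximal 2-connected subgraphs / bridges) of G.
record StarCactus (G : Graph) : Set where
  field
    centre       : Fin (n G)
    k            : ℕ
    blocks       : Fin k → Block (n G)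
    injective    : ∀ b → Injective _≡_ _≡_ (verts (blocks b))
    at-centre    : ∀ b → verts (blocks b) Fin.zero ≡ centre
    edges-in-G   : ∀ b x y → BlockEdge (blocks b) x y → _~_ G x y
    edges-cover  : ∀ x y → _~_ G x y → ∃[ b ] BlockEdge (blocks b) x y
    share-centre : ∀ b b' v → b ≢ b' → InBlock (blocks b) v →
                   InBlock (blocks b') v → v ≡ centre
    verts-cover  : ∀ v → ∃[ b ] InBlock (blocks b) v
open StarCactus public

TwoK₂Blocks : ∀ {G} → StarCactus G → Set
TwoK₂Blocks C = ∃[ b ] ∃[ b' ] (b ≢ b' × IsK₂Block (blocks C b) × IsK₂Block (blocks C b'))

GoodCondition : (G : Graph) → StarCactus G → Set
GoodCondition G C = AllCyclesAtMost G 5 ×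
  (HasCycleOfLength G 3 ⊎ HasCycleOfLength G 4 ⊎ TwoK₂Blocks C)

module Submission where

-- Staller moving first takes the centre c.  In every block the vertex x₁ next to c (a K₂ leaf,
-- or the second vertex of a cycle c x₁ x₂ …) is then isolated as soon as Staller also takes its
-- other neighbour, and Dominator cannot defuse the threats coming from two blocks.
--
-- Dominator moving first must open with c: otherwise Staller takes c and, given a block of length
-- at least 5, has three threats (x₂ and the second-to-last vertex of that block, x₂ of another
-- one).  After the centre opening, a block of length at least 6 lets Staller take x₃ and threaten
-- x₂ and x₄ at once; and if all blocks are 5-cycles apart from at most one K₂, Staller takes x₁
-- and x₄ of each 5-cycle, each time forcing Dominator onto x₃ and x₂, so that in the end only the
-- K₂ leaf could dominate c, and she takes it.  In the remaining case Dominator wins by pairing x₁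
-- with x₃ and x₂ with x₄ in 5-cycles, the two neighbours of c in a 3- or 4-cycle, and two K₂
-- leaves with each other; the last two kinds of pair dominate c.  Since every cycle of G lies in a
-- block, these cases are exactly those of the theorem.

open import Defs
open import Data.Nat as ℕ using (ℕ; zero; suc; _+_; _∸_; _≤_; _<_; z≤n; s≤s)
import Data.Nat.Properties as ℕₚ
open import Data.Fin as Fin using (Fin; toℕ; fromℕ<; #_)
import Data.Fin.Properties as Finₚ
open import Data.Fin.Subset using (Subset; _∈_; _∉_; _∪_; ⁅_⁆; ⊥; ∣_∣; _⊆_)
open import Data.Fin.Subset.Properties
  using (_∈?_; x∈p∪q⁻; p⊆p∪q; q⊆p∪q; x∈⁅x⁆; x∈⁅y⁆⇒x≡y; ∉⊥; ∣p∣≤n; p⊂q⇒∣p∣<∣q∣; ∪-assoc; ∪-comm)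
open import Data.Product using (Σ; ∃; ∃-syntax; _×_; _,_; proj₁; proj₂)
open import Data.Sum as Sum using (_⊎_; inj₁; inj₂)
open import Data.Empty renaming (⊥ to Empty) using (⊥-elim)
open import Relation.Nullary using (¬_; Dec; yes; no; ¬?)
open import Relation.Nullary.Decidable using (_×-dec_; _⊎-dec_; _→-dec_; from-yes)
open import Relation.Binary.PropositionalEquality
  using (_≡_; _≢_; refl; trans; cong; subst; subst₂; module ≡-Reasoning)
  renaming (sym to ≡-sym)
open import Function.Definitions using (Injective)
open import Function.Bundles using (_⇔_; mk⇔)

∈-∪⁅⁆⁻ : ∀ {m} {x : Fin m} P v → x ∈ P ∪ ⁅ v ⁆ → x ∈ P ⊎ x ≡ v
∈-∪⁅⁆⁻ P v x∈ with x∈p∪q⁻ P ⁅ v ⁆ x∈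
... | inj₁ x∈P = inj₁ x∈P
... | inj₂ x∈v = inj₂ (x∈⁅y⁆⇒x≡y v x∈v)

∈-∪⁅⁆⁺ : ∀ {m} (P : Subset m) v → v ∈ P ∪ ⁅ v ⁆
∈-∪⁅⁆⁺ P v = q⊆p∪q P ⁅ v ⁆ (x∈⁅x⁆ v)

∉-∪⁅⁆ : ∀ {m} {x : Fin m} {P} v → x ∉ P → x ≢ v → x ∉ P ∪ ⁅ v ⁆
∉-∪⁅⁆ {P = P} v x∉P x≢v x∈ with ∈-∪⁅⁆⁻ P v x∈
... | inj₁ x∈P = x∉P x∈P
... | inj₂ x≡v = x≢v x≡v

∣∪⁅⁆∣-grows : ∀ {m} (P : Subset m) {v} → v ∉ P → ∣ P ∣ < ∣ P ∪ ⁅ v ⁆ ∣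
∣∪⁅⁆∣-grows P {v} v∉P = p⊂q⇒∣p∣<∣q∣ (p⊆p∪q ⁅ v ⁆ , v , ∈-∪⁅⁆⁺ P v , v∉P)

∈-⊥∪⁅⁆⁻ : ∀ {m} {x v : Fin m} → x ∈ ⊥ ∪ ⁅ v ⁆ → x ≡ v
∈-⊥∪⁅⁆⁻ {v = v} x∈ with ∈-∪⁅⁆⁻ ⊥ v x∈
... | inj₁ x∈⊥ = ⊥-elim (∉⊥ x∈⊥)
... | inj₂ x≡v = x≡v

∈-∪⁅⁆∪⁅⁆⁻ : ∀ {m} {x : Fin m} P v v′ → x ∈ (P ∪ ⁅ v ⁆) ∪ ⁅ v′ ⁆ → x ∈ P ⊎ x ≡ v ⊎ x ≡ v′
∈-∪⁅⁆∪⁅⁆⁻ P v v′ x∈ with ∈-∪⁅⁆⁻ (P ∪ ⁅ v ⁆) v′ x∈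
... | inj₂ x≡v′ = inj₂ (inj₂ x≡v′)
... | inj₁ x∈ with ∈-∪⁅⁆⁻ P v x∈
...   | inj₁ x∈P = inj₁ x∈P
...   | inj₂ x≡v = inj₂ (inj₁ x≡v)

∪⁅⁆-∪-comm : ∀ {m} (D S : Subset m) v → (D ∪ ⁅ v ⁆) ∪ S ≡ (D ∪ S) ∪ ⁅ v ⁆
∪⁅⁆-∪-comm D S v = begin
  (D ∪ ⁅ v ⁆) ∪ S  ≡⟨ ∪-assoc D ⁅ v ⁆ S ⟩
  D ∪ (⁅ v ⁆ ∪ S)  ≡⟨ cong (D ∪_) (∪-comm ⁅ v ⁆ S) ⟩
  D ∪ (S ∪ ⁅ v ⁆)  ≡⟨ ∪-assoc D S ⁅ v ⁆ ⟨
  (D ∪ S) ∪ ⁅ v ⁆  ∎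
  where open ≡-Reasoning

module MakerBreaker (G : Graph) where

  private
    N : ℕ
    N = n G
    V : Set
    V = Fin N
    _≈_ : V → V → Set
    _≈_ = _~_ G

  Disjoint : Subset N → Subset N → Set
  Disjoint D S = ∀ v → v ∈ D → v ∉ S

  -- f bounds the number of moves still to be played; strategies recurse on it.
  record Bounded (f : ℕ) (D S : Subset N) : Set where
    constructor bounded
    field
      disjoint : Disjoint D S
      room     : N ≤ f + ∣ D ∪ S ∣
  open Bounded

  Legal : Subset N → Subset N → Set
  Legal D S = ∃[ f ] Bounded f D S

  free-∉-∪ : ∀ {D S v} → Free {N} D S v → v ∉ D ∪ S
  free-∉-∪ {D} {S} (v∉D , v∉S) v∈ with x∈p∪q⁻ D S v∈
  ... | inj₁ v∈D = v∉D v∈D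
  ... | inj₂ v∈S = v∉S v∈S

  bounded-move : ∀ {f D S D′ S′ v} → Bounded (suc f) D S → Free {N} D S v →
                 D′ ∪ S′ ≡ (D ∪ S) ∪ ⁅ v ⁆ → Disjoint D′ S′ → Bounded f D′ S′
  bounded-move {f} {D} {S} {D′} {S′} {v} b fr eq dj = bounded dj (begin
    N                          ≤⟨ room b ⟩
    suc f + ∣ D ∪ S ∣          ≡⟨ ℕₚ.+-suc f _ ⟨
    f + suc ∣ D ∪ S ∣          ≤⟨ ℕₚ.+-monoʳ-≤ f (∣∪⁅⁆∣-grows (D ∪ S) (free-∉-∪ fr)) ⟩
    f + ∣ (D ∪ S) ∪ ⁅ v ⁆ ∣    ≡⟨ cong (λ P → f + ∣ P ∣) eq ⟨
    f + ∣ D′ ∪ S′ ∣            ∎)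
    where open ℕₚ.≤-Reasoning

  full-at-zero : ∀ {D S v} → Bounded 0 D S → ¬ Free {N} D S v
  full-at-zero {D} {S} {v} b fr = ℕₚ.<-irrefl refl (begin-strict
    N                        ≤⟨ room b ⟩
    ∣ D ∪ S ∣                <⟨ ∣∪⁅⁆∣-grows (D ∪ S) (free-∉-∪ fr) ⟩
    ∣ (D ∪ S) ∪ ⁅ v ⁆ ∣      ≤⟨ ∣p∣≤n ((D ∪ S) ∪ ⁅ v ⁆) ⟩
    N                        ∎)
    where open ℕₚ.≤-Reasoning

  disjoint-dominator : ∀ {D S v} → Disjoint D S → Free {N} D S v → Disjoint (D ∪ ⁅ v ⁆) S
  disjoint-dominator {D} {S} {v} dj (_ , v∉S) u u∈ with ∈-∪⁅⁆⁻ D v u∈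
  ... | inj₁ u∈D = dj u u∈D
  ... | inj₂ refl = v∉S

  disjoint-staller : ∀ {D S v} → Disjoint D S → Free {N} D S v → Disjoint D (S ∪ ⁅ v ⁆)
  disjoint-staller {D} {S} {v} dj (v∉D , _) u u∈D u∈ with ∈-∪⁅⁆⁻ S v u∈
  ... | inj₁ u∈S = dj u u∈D u∈S
  ... | inj₂ refl = v∉D u∈D

  bounded-dominator : ∀ {f D S v} → Bounded (suc f) D S → Free {N} D S v → Bounded f (D ∪ ⁅ v ⁆) S
  bounded-dominator {D = D} {S} {v} b fr =
    bounded-move b fr (∪⁅⁆-∪-comm D S v) (disjoint-dominator (disjoint b) fr)

  bounded-staller : ∀ {f D S v} → Bounded (suc f) D S → Free {N} D S v → Bounded f D (S ∪ ⁅ v ⁆)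
  bounded-staller {D = D} {S} {v} b fr =
    bounded-move b fr (≡-sym (∪-assoc D S ⁅ v ⁆)) (disjoint-staller (disjoint b) fr)

  legal-start : Legal ⊥ ⊥
  legal-start = N , bounded (λ _ v∈⊥ _ → ∉⊥ v∈⊥) (ℕₚ.m≤m+n N _)

  legal-dominator : ∀ {D S v} → Legal D S → Free {N} D S v → Legal (D ∪ ⁅ v ⁆) S
  legal-dominator (zero , b) fr = ⊥-elim (full-at-zero b fr)
  legal-dominator (suc f , b) fr = f , bounded-dominator b fr

  legal-staller : ∀ {D S v} → Legal D S → Free {N} D S v → Legal D (S ∪ ⁅ v ⁆)
  legal-staller (zero , b) fr = ⊥-elim (full-at-zero b fr)
  legal-staller (suc f , b) fr = f , bounded-staller b fr

  free-start : ∀ v → Free {N} ⊥ ⊥ v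
  free-start v = ∉⊥ , ∉⊥

  ¬totalDominating-⊥ : V → ¬ IsTotalDominating G ⊥
  ¬totalDominating-⊥ v td = ∉⊥ (proj₁ (proj₂ (td v)))

  ¬totalDominating-⁅⁆ : ∀ v → ¬ IsTotalDominating G (⊥ ∪ ⁅ v ⁆)
  ¬totalDominating-⁅⁆ v td with td v
  ... | u , u∈D , v~u with ∈-⊥∪⁅⁆⁻ u∈D
  ... | refl = irrefl G v~u

  domWins⇒¬stalWins : ∀ {D S p} → DomWins G D S p → ¬ StalWins G D S p
  domWins⇒¬stalWins (dom-done td)          (stal-done ¬td _)     = ¬td td
  domWins⇒¬stalWins (dom-done td)          (stal-move ¬td _ _ _) = ¬td td
  domWins⇒¬stalWins (dom-done td)          (dom-move ¬td _)      = ¬td td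
  domWins⇒¬stalWins (dom-move v fr _)      (stal-done _ full)    = full v fr
  domWins⇒¬stalWins (dom-move v fr d)      (dom-move _ s)        = domWins⇒¬stalWins d (s v fr)
  domWins⇒¬stalWins (stal-move (v , fr) _) (stal-done _ full)    = full v fr
  domWins⇒¬stalWins (stal-move _ d)        (stal-move _ v fr s)  = domWins⇒¬stalWins (d v fr) s

  Isolated : Subset N → V → Set
  Isolated S x = ∀ u → x ≈ u → u ∈ S

  isolated⇒¬totalDominating : ∀ {D S x} → Disjoint D S → Isolated S x → ¬ IsTotalDominating G D
  isolated⇒¬totalDominating dj iso td with td _
  ... | u , u∈D , x~u = dj u u∈D (iso u x~u)

  isolated-staller : ∀ {S v x} → Isolated S x → Isolated (S ∪ ⁅ v ⁆) x
  isolated-staller {S} {v} iso u x~u = p⊆p∪q ⁅ v ⁆ (iso u x~u)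

  free? : ∀ D S v → Dec (Free {N} D S v)
  free? D S v = ¬? (v ∈? D) ×-dec ¬? (v ∈? S)

  stalWins-isolatedᶠ : ∀ f {D S} p x → Bounded f D S → Isolated S x → StalWins G D S p
  stalWins-isolatedᶠ f {D} {S} p x b iso with Finₚ.any? (free? D S)
  ... | no full = stal-done ¬td (λ v fr → full (v , fr))
    where ¬td = isolated⇒¬totalDominating (disjoint b) iso
  stalWins-isolatedᶠ zero p x b iso | yes (v , fr) = ⊥-elim (full-at-zero b fr)
  stalWins-isolatedᶠ (suc f) staller x b iso | yes (v , fr) =
    stal-move (isolated⇒¬totalDominating (disjoint b) iso) v fr
      (stalWins-isolatedᶠ f dominator x (bounded-staller b fr) (isolated-staller iso))
  stalWins-isolatedᶠ (suc f) dominator x b iso | yes _ =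
    dom-move (isolated⇒¬totalDominating (disjoint b) iso) λ w fr →
      stalWins-isolatedᶠ f staller x (bounded-dominator b fr) iso

  stalWins-isolated : ∀ {D S} p x → Legal D S → Isolated S x → StalWins G D S p
  stalWins-isolated p x (f , b) = stalWins-isolatedᶠ f p x b

  stalWins-threat : ∀ {D S} x y → Legal D S → Free {N} D S y →
                    (∀ u → x ≈ u → u ∈ S ⊎ u ≡ y) → StalWins G D S staller
  stalWins-threat {D} {S} x y l fr@(y∉D , _) nbrs =
    stal-move ¬td y fr (stalWins-isolated dominator x (legal-staller l fr) iso)
    where
    iso : Isolated (S ∪ ⁅ y ⁆) x
    iso u x~u with nbrs u x~u
    ... | inj₁ u∈S = p⊆p∪q ⁅ y ⁆ u∈S
    ... | inj₂ refl = ∈-∪⁅⁆⁺ S y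
    ¬td : ¬ IsTotalDominating G D
    ¬td td with td x
    ... | u , u∈D , x~u with nbrs u x~u
    ...   | inj₁ u∈S = disjoint (proj₂ l) u u∈D u∈S
    ...   | inj₂ refl = y∉D u∈D

  -- Dominator's pairing strategy: whenever Staller takes a vertex, Dominator takes its mate.
  module Pairing (σ : V → V) (σ-involutive : ∀ u → σ (σ u) ≡ u) where

    Covers : Subset N → Set
    Covers D = ∀ u → σ u ≢ u → u ∈ D ⊎ σ u ∈ D

    Intact : Subset N → Subset N → Set
    Intact D S = ∀ u → σ u ≢ u → u ∈ D ⊎ σ u ∈ D ⊎ (u ∉ S × σ u ∉ S)

    intact-dominator : ∀ {D S} w → Intact D S → Intact (D ∪ ⁅ w ⁆) S
    intact-dominator w it u σu≢u with it u σu≢u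
    ... | inj₁ u∈D = inj₁ (p⊆p∪q ⁅ w ⁆ u∈D)
    ... | inj₂ (inj₁ σu∈D) = inj₂ (inj₁ (p⊆p∪q ⁅ w ⁆ σu∈D))
    ... | inj₂ (inj₂ untouched) = inj₂ (inj₂ untouched)

    intact-staller : ∀ {D S} v → Intact D S → σ v ≡ v ⊎ σ v ∈ D → Intact D (S ∪ ⁅ v ⁆)
    intact-staller {D} {S} v it safe u σu≢u with u Finₚ.≟ v | σ u Finₚ.≟ v | safe
    ... | yes refl | _ | inj₁ σv≡v = ⊥-elim (σu≢u σv≡v)
    ... | yes refl | _ | inj₂ σv∈D = inj₂ (inj₁ σv∈D)
    ... | no _ | yes σu≡v | inj₁ σv≡v =
      ⊥-elim (σu≢u (trans σu≡v (trans (≡-sym σv≡v) (trans (cong σ (≡-sym σu≡v)) (σ-involutive u)))))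
    ... | no _ | yes refl | inj₂ σσu∈D = inj₁ (subst (_∈ D) (σ-involutive u) σσu∈D)
    ... | no u≢v | no σu≢v | _ with it u σu≢u
    ...   | inj₁ u∈D = inj₁ u∈D
    ...   | inj₂ (inj₁ σu∈D) = inj₂ (inj₁ σu∈D)
    ...   | inj₂ (inj₂ (u∉S , σu∉S)) = inj₂ (inj₂ (∉-∪⁅⁆ v u∉S u≢v , ∉-∪⁅⁆ v σu∉S σu≢v))

    intact-reply : ∀ {D S} v → Intact D S → Intact (D ∪ ⁅ σ v ⁆) (S ∪ ⁅ v ⁆)
    intact-reply {D} {S} v it u σu≢u with u Finₚ.≟ v | σ u Finₚ.≟ v
    ... | yes refl | _ = inj₂ (inj₁ (∈-∪⁅⁆⁺ D (σ u)))
    ... | no _ | yes refl = inj₁ (subst (_∈ D ∪ ⁅ σ (σ u) ⁆) (σ-involutive u) (∈-∪⁅⁆⁺ D (σ (σ u))))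
    ... | no u≢v | no σu≢v with it u σu≢u
    ...   | inj₁ u∈D = inj₁ (p⊆p∪q ⁅ σ v ⁆ u∈D)
    ...   | inj₂ (inj₁ σu∈D) = inj₂ (inj₁ (p⊆p∪q ⁅ σ v ⁆ σu∈D))
    ...   | inj₂ (inj₂ (u∉S , σu∉S)) = inj₂ (inj₂ (∉-∪⁅⁆ v u∉S u≢v , ∉-∪⁅⁆ v σu∉S σu≢v))

    intact-full⇒covers : ∀ {D S} → Intact D S → (∀ v → ¬ Free {N} D S v) → Covers D
    intact-full⇒covers {D} it full u σu≢u with it u σu≢u
    ... | inj₁ u∈D = inj₁ u∈D
    ... | inj₂ (inj₁ σu∈D) = inj₂ σu∈D
    ... | inj₂ (inj₂ (u∉S , _)) with u ∈? D
    ...   | yes u∈D = inj₁ u∈D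
    ...   | no u∉D = ⊥-elim (full u (u∉D , u∉S))

    module _ (D₀ : Subset N) (win : ∀ D → D₀ ⊆ D → Covers D → IsTotalDominating G D) where

      private
        grow : ∀ {D} v → D₀ ⊆ D → D₀ ⊆ D ∪ ⁅ v ⁆
        grow v D₀⊆D x∈ = p⊆p∪q ⁅ v ⁆ (D₀⊆D x∈)

      mutual
        pairingᶠ : ∀ f {D S} p → Bounded f D S → D₀ ⊆ D → Intact D S → DomWins G D S p
        pairingᶠ f {D} {S} p b D₀⊆D it with Finₚ.any? (free? D S)
        ... | no full = dom-done (win D D₀⊆D (intact-full⇒covers it λ v fr → full (v , fr)))
        pairingᶠ zero p b D₀⊆D it | yes (_ , fr) = ⊥-elim (full-at-zero b fr)
        pairingᶠ (suc f) dominator b D₀⊆D it | yes (w , fr) =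
          dom-move w fr (pairingᶠ f staller (bounded-dominator b fr) (grow w D₀⊆D) (intact-dominator w it))
        pairingᶠ (suc f) staller b D₀⊆D it | yes some =
          stal-move some λ v fr → reply f v (bounded-staller b fr) fr D₀⊆D it

        reply : ∀ f {D S} v → Bounded f D (S ∪ ⁅ v ⁆) → Free {N} D S v → D₀ ⊆ D → Intact D S →
                DomWins G D (S ∪ ⁅ v ⁆) dominator
        reply f {D} {S} v b fr D₀⊆D it with σ v Finₚ.≟ v | σ v ∈? D
        ... | yes σv≡v | _ = pairingᶠ f dominator b D₀⊆D (intact-staller v it (inj₁ σv≡v))
        ... | no _ | yes σv∈D = pairingᶠ f dominator b D₀⊆D (intact-staller v it (inj₂ σv∈D))
        ... | no σv≢v | no σv∉D with it v σv≢v | f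
        ...   | inj₁ v∈D | _ = ⊥-elim (proj₁ fr v∈D)
        ...   | inj₂ (inj₁ σv∈D) | _ = ⊥-elim (σv∉D σv∈D)
        ...   | inj₂ (inj₂ (_ , σv∉S)) | zero = ⊥-elim (full-at-zero b mate-free)
          where mate-free = σv∉D , ∉-∪⁅⁆ v σv∉S σv≢v
        ...   | inj₂ (inj₂ (_ , σv∉S)) | suc f′ =
          dom-move (σ v) mate-free
            (pairingᶠ f′ staller (bounded-dominator b mate-free) (grow (σ v) D₀⊆D) (intact-reply v it))
          where mate-free = σv∉D , ∉-∪⁅⁆ v σv∉S σv≢v

      domWins-pairing : ∀ {D S} p → Legal D S → D₀ ⊆ D → Intact D S → DomWins G D S p
      domWins-pairing p (f , b) = pairingᶠ f p b

interval-up : ∀ (P : ℕ → Set) {lo hi} → P lo → (∀ t → lo ≤ t → t < hi → P t → P (suc t)) →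
              ∀ t → lo ≤ t → t ≤ hi → P t
interval-up P {lo} base step t lo≤t t≤hi with ℕₚ.m≤n⇒m<n∨m≡n lo≤t
... | inj₂ refl = base
interval-up P base step (suc t) _ t<hi | inj₁ (s≤s lo≤t) =
  step t lo≤t t<hi (interval-up P base step t lo≤t (ℕₚ.<⇒≤ t<hi))

interval-down : ∀ (P : ℕ → Set) {lo hi} → P hi → (∀ t → lo ≤ t → t < hi → P (suc t) → P t) →
                ∀ t → lo ≤ t → t ≤ hi → P t
interval-down P {lo} {hi} base step t lo≤t t≤hi = go (hi ∸ t) t (ℕₚ.m+[n∸m]≡n t≤hi) lo≤t
  where
  go : ∀ d t → t + d ≡ hi → lo ≤ t → P t
  go zero t eq _ = subst P (trans (≡-sym eq) (ℕₚ.+-identityʳ t)) base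
  go (suc d) t eq lo≤t = step t lo≤t t<hi (go d (suc t) (trans (≡-sym (ℕₚ.+-suc t d)) eq) (ℕₚ.m≤n⇒m≤1+n lo≤t))
    where
    t<hi : t < hi
    t<hi = subst (t <_) eq (ℕₚ.m<m+n t (s≤s z≤n))

-- `CycAdj m i j` is by definition `CycAdjℕ m (toℕ i) (toℕ j)`.
CycStepℕ : ℕ → ℕ → ℕ → Set
CycStepℕ m t t′ = t′ ≡ suc t ⊎ (t ≡ m ∸ 1 × t′ ≡ 0)

CycAdjℕ : ℕ → ℕ → ℕ → Set
CycAdjℕ m t t′ = CycStepℕ m t t′ ⊎ CycStepℕ m t′ t

cycAdjℕ-sym : ∀ {m t t′} → CycAdjℕ m t t′ → CycAdjℕ m t′ t
cycAdjℕ-sym (inj₁ s) = inj₂ s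
cycAdjℕ-sym (inj₂ s) = inj₁ s

3≤l≤5⇒l≡3∨4∨5 : ∀ {l} → 3 ≤ l → l ≤ 5 → l ≡ 3 ⊎ l ≡ 4 ⊎ l ≡ 5
3≤l≤5⇒l≡3∨4∨5 {1} (s≤s ()) _
3≤l≤5⇒l≡3∨4∨5 {2} (s≤s (s≤s ())) _
3≤l≤5⇒l≡3∨4∨5 {3} _ _ = inj₁ refl
3≤l≤5⇒l≡3∨4∨5 {4} _ _ = inj₂ (inj₁ refl)
3≤l≤5⇒l≡3∨4∨5 {5} _ _ = inj₂ (inj₂ refl)
3≤l≤5⇒l≡3∨4∨5 {suc (suc (suc (suc (suc (suc _)))))} _ (s≤s (s≤s (s≤s (s≤s (s≤s ())))))

cycAdj? : ∀ m (i j : Fin m) → Dec (CycAdj m i j)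
cycAdj? m i j = step? i j ⊎-dec step? j i
  where
  step? : ∀ i j → Dec (CycStep m i j)
  step? i j = (toℕ j ℕ.≟ suc (toℕ i)) ⊎-dec ((toℕ i ℕ.≟ m ∸ 1) ×-dec (toℕ j ℕ.≟ 0))

C₅-triangle-free : ∀ {l} → l ≡ 5 → (a b d : Fin l) → ¬ (CycAdj l a b × CycAdj l b d × CycAdj l d a)
C₅-triangle-free refl = from-yes (Finₚ.all? λ a → Finₚ.all? λ b → Finₚ.all? λ d →
  ¬? (cycAdj? 5 a b ×-dec cycAdj? 5 b d ×-dec cycAdj? 5 d a))

C₅-square-free : ∀ {l} → l ≡ 5 → (a b d e : Fin l) → a ≢ d → b ≢ e →
                 ¬ (CycAdj l a b × CycAdj l b d × CycAdj l d e × CycAdj l e a)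
C₅-square-free refl = from-yes (Finₚ.all? λ a → Finₚ.all? λ b → Finₚ.all? λ d → Finₚ.all? λ e →
  ¬? (a Finₚ.≟ d) →-dec ¬? (b Finₚ.≟ e) →-dec
  ¬? (cycAdj? 5 a b ×-dec cycAdj? 5 b d ×-dec cycAdj? 5 d e ×-dec cycAdj? 5 e a))

module StarCactusGeometry (G : Graph) (C : StarCactus G) where

  private
    V : Set
    V = Fin (n G)
    _≈_ : V → V → Set
    _≈_ = _~_ G

  c : V
  c = centre C

  B : Fin (k C) → Block (n G)
  B = blocks C

  L : Fin (k C) → ℕ
  L b = len (B b)

  w : ∀ b → Fin (L b) → V
  w b = verts (B b)

  w-injective : ∀ b → Injective _≡_ _≡_ (w b)
  w-injective = injective C

  w-≢centre : ∀ b {i} → i ≢ Fin.zero → w b i ≢ c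
  w-≢centre b i≢0 eq = i≢0 (w-injective b (trans eq (≡-sym (at-centre C b))))

  same-block : ∀ {b b′ i j} → w b i ≡ w b′ j → i ≢ Fin.zero → b ≡ b′
  same-block {b} {b′} {i} {j} eq i≢0 with b Finₚ.≟ b′
  ... | yes b≡b′ = b≡b′
  ... | no b≢b′ = ⊥-elim (w-≢centre b i≢0 (share-centre C b b′ (w b i) b≢b′ (i , refl) (j , ≡-sym eq)))

  neighbour-index : ∀ {b i u} → i ≢ Fin.zero → w b i ≈ u → ∃[ j ] (w b j ≡ u × CycAdj (L b) i j)
  neighbour-index {b} {i} {u} i≢0 wi~u with edges-cover C (w b i) u wi~u
  ... | b′ , i′ , j , adj , wi′≡wi , wj≡u with same-block {b} {b′} (≡-sym wi′≡wi) i≢0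
  ... | refl with w-injective b wi′≡wi
  ... | refl = j , wj≡u , adj

  inBlock-neighbour : ∀ {b x u} → InBlock (B b) x → x ≢ c → x ≈ u → InBlock (B b) u
  inBlock-neighbour {b} (i , refl) x≢c x~u with neighbour-index (λ { refl → x≢c (at-centre C b) }) x~u
  ... | j , wj≡u , _ = j , wj≡u

  adjacent⇒cycAdj : ∀ b {i j} → w b i ≈ w b j → CycAdj (L b) i j
  adjacent⇒cycAdj b {Fin.zero} {Fin.zero} wi~wj = ⊥-elim (irrefl G wi~wj)
  adjacent⇒cycAdj b {Fin.zero} {Fin.suc j} wi~wj with neighbour-index (λ ()) (Graph.sym G wi~wj)
  ... | j′ , eq , adj with w-injective b eq
  ... | refl = cycAdjℕ-sym {L b} adj
  adjacent⇒cycAdj b {Fin.suc i} wi~wj with neighbour-index (λ ()) wi~wj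
  ... | j′ , eq , adj with w-injective b eq
  ... | refl = adj

  module _ {m} {f : Fin m → V} (cyc : IsCycle G m f) where

    private
      fℕ : ∀ t → t < m → V
      fℕ t q = f (fromℕ< q)

      InB : Fin (k C) → ℕ → Set
      InB b t = (q : t < m) → InBlock (B b) (fℕ t q)

      0<m : 0 < m
      0<m = ℕₚ.<-≤-trans (s≤s z≤n) (proj₁ cyc)

      top<m : m ∸ 1 < m
      top<m = ℕₚ.∸-monoʳ-< {m} {1} {0} (s≤s z≤n) 0<m

      ≤top : ∀ {t} → t < m → t ≤ m ∸ 1
      ≤top t<m = ℕₚ.∸-monoˡ-≤ 1 t<m

      step-adjacent : ∀ t (q : t < m) (q′ : suc t < m) → fℕ t q ≈ fℕ (suc t) q′
      step-adjacent t q q′ = proj₂ (proj₂ cyc) (fromℕ< q) (fromℕ< q′)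
        (inj₁ (inj₁ (trans (Finₚ.toℕ-fromℕ< q′) (cong suc (≡-sym (Finₚ.toℕ-fromℕ< q))))))

      wrap-adjacent : fℕ (m ∸ 1) top<m ≈ fℕ 0 0<m
      wrap-adjacent = proj₂ (proj₂ cyc) (fromℕ< top<m) (fromℕ< 0<m)
        (inj₁ (inj₂ (Finₚ.toℕ-fromℕ< top<m , Finₚ.toℕ-fromℕ< 0<m)))

      CentreOnlyAt : ℕ → Set
      CentreOnlyAt j₀ = ∀ t (q : t < m) → t ≢ j₀ → fℕ t q ≢ c

      centre-at-most-once : ∃[ j₀ ] (j₀ < m × CentreOnlyAt j₀)
      centre-at-most-once with Finₚ.any? (λ i → f i Finₚ.≟ c)
      ... | no none = 0 , 0<m , λ t q _ eq → none (fromℕ< q , eq)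
      ... | yes (i , fi≡c) = toℕ i , Finₚ.toℕ<n i , λ t q t≢i eq →
        t≢i (trans (≡-sym (Finₚ.toℕ-fromℕ< q)) (cong toℕ (proj₁ (proj₂ cyc) (trans eq (≡-sym fi≡c)))))

      walk-up : ∀ {b j₀} → CentreOnlyAt j₀ → ∀ t → 0 ≤ t → t < j₀ → InB b t → InB b (suc t)
      walk-up nc t _ t<j₀ h q′ = inBlock-neighbour (h q) (nc t q (ℕₚ.<⇒≢ t<j₀)) (step-adjacent t q q′)
        where q = ℕₚ.<-trans (ℕₚ.n<1+n t) q′

      walk-down : ∀ {b j₀} → CentreOnlyAt j₀ → ∀ t → j₀ ≤ t → t < m ∸ 1 → InB b (suc t) → InB b t
      walk-down nc t j₀≤t t<top h q =
        inBlock-neighbour (h q′) (nc (suc t) q′ (λ eq → ℕₚ.<⇒≢ (s≤s j₀≤t) (≡-sym eq)))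
          (Graph.sym G (step-adjacent t q q′))
        where q′ = ℕₚ.<-≤-trans (s≤s t<top) top<m

      inB⇒inBlock : ∀ {b} → (∀ t → t < m → InB b t) → ∀ i → InBlock (B b) (f i)
      inB⇒inBlock {b} h i = subst (InBlock (B b)) (cong f (Finₚ.fromℕ<-toℕ i (Finₚ.toℕ<n i)))
                                  (h (toℕ i) (Finₚ.toℕ<n i) (Finₚ.toℕ<n i))

    -- A walk along the cycle stays in one block as long as it avoids the centre, which the cycle
    -- meets at most once, at j₀.  Walk up from 0 and down from m ∸ 1 to j₀; the edge from m ∸ 1
    -- to 0 joins the two walks unless j₀ = m ∸ 1, in which case the upward walk suffices.
    cycle-in-block : ∃[ b ] ∀ i → InBlock (B b) (f i)
    cycle-in-block with centre-at-most-once
    ... | j₀ , j₀<m , nc with j₀ ℕ.≟ m ∸ 1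
    ...   | yes refl = b , inB⇒inBlock λ t t<m →
              interval-up (InB b) (λ _ → start) (walk-up nc) t z≤n (≤top t<m)
      where
      b = proj₁ (verts-cover C (fℕ 0 0<m))
      start = proj₂ (verts-cover C (fℕ 0 0<m))
    ...   | no j₀≢top = b , inB⇒inBlock λ t t<m → lower-or-upper t (≤top t<m)
      where
      b = proj₁ (verts-cover C (fℕ (m ∸ 1) top<m))
      start = proj₂ (verts-cover C (fℕ (m ∸ 1) top<m))
      upper : ∀ t → j₀ ≤ t → t ≤ m ∸ 1 → InB b t
      upper = interval-down (InB b) (λ _ → start) (walk-down nc)
      first : InB b 0
      first _ = inBlock-neighbour (upper (m ∸ 1) (≤top j₀<m) ℕₚ.≤-refl top<m)
                  (nc (m ∸ 1) top<m (λ eq → j₀≢top (≡-sym eq))) wrap-adjacent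
      lower-or-upper : ∀ t → t ≤ m ∸ 1 → InB b t
      lower-or-upper t t≤top with t ℕ.≤? j₀
      ... | yes t≤j₀ = interval-up (InB b) first (walk-up nc) t z≤n t≤j₀
      ... | no t≰j₀ = upper t (ℕₚ.<⇒≤ (ℕₚ.≰⇒> t≰j₀)) t≤top

    block-embedding : ∃[ b ] Σ (Fin m → Fin (L b)) λ g →
                        Injective _≡_ _≡_ g × (∀ i j → CycAdj m i j → CycAdj (L b) (g i) (g j))
    block-embedding with cycle-in-block
    ... | b , h = b , g , g-injective , g-adjacent
      where
      g : Fin m → Fin (L b)
      g i = proj₁ (h i)
      g-injective : Injective _≡_ _≡_ g
      g-injective {i} {j} eq =
        proj₁ (proj₂ cyc) (trans (≡-sym (proj₂ (h i))) (trans (cong (w b) eq) (proj₂ (h j))))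
      g-adjacent : ∀ i j → CycAdj m i j → CycAdj (L b) (g i) (g j)
      g-adjacent i j adj = adjacent⇒cycAdj b
        (subst₂ _≈_ (≡-sym (proj₂ (h i))) (≡-sym (proj₂ (h j))) (proj₂ (proj₂ cyc) i j adj))

    cycle-length≤block : ∃[ b ] m ≤ L b
    cycle-length≤block with block-embedding
    ... | b , _ , g-injective , _ = b , Finₚ.injective⇒≤ g-injective

  block-cycle : ∀ b → 3 ≤ L b → IsCycle G (L b) (w b)
  block-cycle b 3≤L = 3≤L , w-injective b , λ i j adj → edges-in-G C b _ _ (i , j , adj , refl , refl)

  short-cycle⇒short-block : (∀ b → L b ≤ 5) → ∀ {m} → m ≡ 3 ⊎ m ≡ 4 → HasCycleOfLength G m →
                            ∃[ b ] (L b ≡ 3 ⊎ L b ≡ 4)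
  short-cycle⇒short-block small {m} m≡3∨4 (f , cyc) with block-embedding cyc
  ... | b , g , g-injective , g-adjacent
      with 3≤l≤5⇒l≡3∨4∨5 (ℕₚ.≤-trans (proj₁ cyc) (Finₚ.injective⇒≤ g-injective)) (small b)
  ...   | inj₁ L≡3 = b , inj₁ L≡3
  ...   | inj₂ (inj₁ L≡4) = b , inj₂ L≡4
  ...   | inj₂ (inj₂ L≡5) = ⊥-elim (no-short-cycle m≡3∨4)
    where
    no-short-cycle : m ≡ 3 ⊎ m ≡ 4 → Empty
    no-short-cycle (inj₁ refl) = C₅-triangle-free L≡5 _ _ _
      (g-adjacent (# 0) (# 1) (inj₁ (inj₁ refl)) ,
       g-adjacent (# 1) (# 2) (inj₁ (inj₁ refl)) ,
       g-adjacent (# 2) (# 0) (inj₁ (inj₂ (refl , refl))))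
    no-short-cycle (inj₂ refl) = C₅-square-free L≡5 _ _ _ _
      (λ eq → 0≢2 (g-injective eq)) (λ eq → 1≢3 (g-injective eq))
      (g-adjacent (# 0) (# 1) (inj₁ (inj₁ refl)) ,
       g-adjacent (# 1) (# 2) (inj₁ (inj₁ refl)) ,
       g-adjacent (# 2) (# 3) (inj₁ (inj₁ refl)) ,
       g-adjacent (# 3) (# 0) (inj₁ (inj₂ (refl , refl))))
      where
      0≢2 : # 0 ≢ # 2
      0≢2 ()
      1≢3 : # 1 ≢ # 3
      1≢3 ()

  At : Fin (k C) → ℕ → V → Set
  At b t u = ∃[ j ] (toℕ j ≡ t × w b j ≡ u)

  vertex : ∀ b t → t < L b → V
  vertex b t t<L = w b (fromℕ< t<L)

  vertex-at : ∀ b t (t<L : t < L b) → At b t (vertex b t t<L)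
  vertex-at b t t<L = fromℕ< t<L , Finₚ.toℕ-fromℕ< t<L , refl

  at-bound : ∀ {b t u} → At b t u → t < L b
  at-bound (j , refl , _) = Finₚ.toℕ<n j

  home : ∀ v → ∃[ b ] ∃[ t ] At b t v
  home v with verts-cover C v
  ... | b , i , wi≡v = b , toℕ i , i , refl , wi≡v

  centre-at-0 : ∀ b → At b 0 c
  centre-at-0 b = Fin.zero , refl , at-centre C b

  at-0⇒centre : ∀ {b u} → At b 0 u → u ≡ c
  at-0⇒centre {b} (Fin.zero , _ , refl) = at-centre C b

  at-functional : ∀ {b t u u′} → At b t u → At b t u′ → u ≡ u′
  at-functional (j , refl , refl) (j′ , tj′ , refl) with Finₚ.toℕ-injective {i = j} {j = j′} (≡-sym tj′)
  ... | refl = refl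

  at-injective : ∀ {b t t′ u} → At b t u → At b t′ u → t ≡ t′
  at-injective {b} (j , refl , refl) (j′ , refl , eq) with w-injective b eq
  ... | refl = refl

  at-unique : ∀ {b b′ t t′ u} → At b t u → At b′ t′ u → t ≢ 0 → b ≡ b′ × t ≡ t′
  at-unique {b} {b′} (j , refl , refl) (j′ , refl , eq) t≢0
    with same-block {b} {b′} (≡-sym eq) (λ { refl → t≢0 refl })
  ... | refl = refl , at-injective (j , refl , refl) (j′ , refl , eq)

  at-≢0⇒≢centre : ∀ {b t u} → At b t u → t ≢ 0 → u ≢ c
  at-≢0⇒≢centre {b} a t≢0 refl = t≢0 (at-injective a (centre-at-0 b))

  at-≢centre⇒≢0 : ∀ {b t u} → At b t u → u ≢ c → t ≢ 0
  at-≢centre⇒≢0 a u≢c refl = u≢c (at-0⇒centre a)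

  at-≢position : ∀ {b t t′ u u′} → At b t u → At b t′ u′ → t ≢ t′ → u ≢ u′
  at-≢position a a′ t≢t′ refl = t≢t′ (at-injective a a′)

  at-≢block : ∀ {b b′ t t′ u u′} → At b t u → At b′ t′ u′ → t ≢ 0 → b ≢ b′ → u ≢ u′
  at-≢block a a′ t≢0 b≢b′ refl = b≢b′ (proj₁ (at-unique a a′ t≢0))

  at-adjacent : ∀ {b t t′ x y} → At b t x → At b t′ y → CycAdjℕ (L b) t t′ → x ≈ y
  at-adjacent {b} (j , refl , refl) (j′ , refl , refl) adj = edges-in-G C b _ _ (j , j′ , adj , refl , refl)

  neighbour-at : ∀ {b t x u} → At b t x → 0 < t → x ≈ u →
                 ∃[ t′ ] (At b t′ u × (t′ ≡ suc t ⊎ suc t′ ≡ t ⊎ (t ≡ L b ∸ 1 × t′ ≡ 0)))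
  neighbour-at {b} (j , refl , refl) 0<t x~u with neighbour-index (λ { refl → ℕₚ.<-irrefl refl 0<t }) x~u
  ... | j′ , wj′≡u , inj₁ (inj₁ up)          = toℕ j′ , (j′ , refl , wj′≡u) , inj₁ up
  ... | j′ , wj′≡u , inj₁ (inj₂ wrap)        = toℕ j′ , (j′ , refl , wj′≡u) , inj₂ (inj₂ wrap)
  ... | j′ , wj′≡u , inj₂ (inj₁ down)        = toℕ j′ , (j′ , refl , wj′≡u) , inj₂ (inj₁ (≡-sym down))
  ... | j′ , wj′≡u , inj₂ (inj₂ (_ , t≡0))   = ⊥-elim (ℕₚ.<-irrefl (≡-sym t≡0) 0<t)

  interior-neighbour : ∀ {b t x u} → At b t x → 0 < t → t ≢ L b ∸ 1 → x ≈ u →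
                       ∃[ t′ ] (At b t′ u × (t′ ≡ suc t ⊎ suc t′ ≡ t))
  interior-neighbour a 0<t t≢last x~u with neighbour-at a 0<t x~u
  ... | t′ , a′ , inj₁ up = t′ , a′ , inj₁ up
  ... | t′ , a′ , inj₂ (inj₁ down) = t′ , a′ , inj₂ down
  ... | t′ , a′ , inj₂ (inj₂ (t≡last , _)) = ⊥-elim (t≢last t≡last)

  first-neighbour : ∀ {b x u} → At b 1 x → x ≈ u → u ≡ c ⊎ At b 2 u
  first-neighbour a x~u with neighbour-at a (s≤s z≤n) x~u
  ... | _ , a′ , inj₁ refl = inj₂ a′
  ... | 0 , a′ , inj₂ (inj₁ refl) = inj₁ (at-0⇒centre a′)
  ... | _ , a′ , inj₂ (inj₂ (_ , refl)) = inj₁ (at-0⇒centre a′)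

  last-neighbour : ∀ {b x u} → At b (L b ∸ 1) x → x ≈ u → u ≡ c ⊎ At b (L b ∸ 2) u
  last-neighbour a x~u with neighbour-at a (s≤s z≤n) x~u
  ... | _ , a′ , inj₁ refl = ⊥-elim (ℕₚ.<-irrefl refl (at-bound a′))
  ... | _ , a′ , inj₂ (inj₁ refl) = inj₂ a′
  ... | _ , a′ , inj₂ (inj₂ (_ , refl)) = inj₁ (at-0⇒centre a′)

  centre-neighbour : ∀ {u} → c ≈ u → ∃[ b ] ∃[ t ] (At b t u × (t ≡ 1 ⊎ t ≡ L b ∸ 1))
  centre-neighbour {u} c~u with home u
  ... | b , t , a with neighbour-at a 0<t (Graph.sym G c~u)
    where
    0<t : 0 < t
    0<t = ℕₚ.n≢0⇒n>0 (at-≢centre⇒≢0 a λ { refl → irrefl G c~u })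
  ... | _ , a′ , inj₁ refl = ⊥-elim (ℕₚ.0≢1+n (≡-sym (at-injective a′ (centre-at-0 b))))
  ... | _ , a′ , inj₂ (inj₁ refl) = b , t , a , inj₁ (cong suc (at-injective a′ (centre-at-0 b)))
  ... | _ , a′ , inj₂ (inj₂ (t≡last , _)) = b , t , a , inj₂ t≡last

  two-blocks : 2 ≤ k C → Σ (Fin (k C)) λ b₀ → Σ (Fin (k C)) λ b₁ → b₀ ≢ b₁
  two-blocks 2≤k = fromℕ< (ℕₚ.<-trans (s≤s z≤n) 2≤k) , fromℕ< 2≤k , λ eq → ℕₚ.0≢1+n
    (trans (≡-sym (Finₚ.toℕ-fromℕ< (ℕₚ.<-trans (s≤s z≤n) 2≤k))) (trans (cong toℕ eq) (Finₚ.toℕ-fromℕ< 2≤k)))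

  K₂-or-cycle : ∀ b → L b ≡ 2 ⊎ 2 < L b
  K₂-or-cycle b with extra (B b)
  ... | zero = inj₁ refl
  ... | suc _ = inj₂ (s≤s (s≤s (s≤s z≤n)))

  L∸2≢0 : ∀ {b} → 2 < L b → L b ∸ 2 ≢ 0
  L∸2≢0 2<L eq = ℕₚ.<-irrefl (≡-sym (cong (2 +_) eq)) 2<L

avoid-one : ∀ {m} {D : Subset m} {a y₁ y₂} → y₁ ≢ y₂ → (∀ u → u ∈ D → u ≡ a) → y₁ ∉ D ⊎ y₂ ∉ D
avoid-one {D = D} {y₁ = y₁} y₁≢y₂ D⊆a with y₁ ∈? D
... | no y₁∉D = inj₁ y₁∉D
... | yes y₁∈D = inj₂ λ y₂∈D → y₁≢y₂ (trans (D⊆a _ y₁∈D) (≡-sym (D⊆a _ y₂∈D)))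

avoid-two : ∀ {m} {D : Subset m} {a a′ y₁ y₂ y₃} → y₁ ≢ y₂ → y₁ ≢ y₃ → y₂ ≢ y₃ →
            (∀ u → u ∈ D → u ≡ a ⊎ u ≡ a′) → y₁ ∉ D ⊎ y₂ ∉ D ⊎ y₃ ∉ D
avoid-two {D = D} {y₁ = y₁} {y₂} {y₃} y₁≢y₂ y₁≢y₃ y₂≢y₃ D⊆aa′ with y₁ ∈? D | y₂ ∈? D
... | no y₁∉D | _ = inj₁ y₁∉D
... | yes _ | no y₂∉D = inj₂ (inj₁ y₂∉D)
... | yes y₁∈D | yes y₂∈D = inj₂ (inj₂ λ y₃∈D → clash (D⊆aa′ _ y₁∈D) (D⊆aa′ _ y₂∈D) (D⊆aa′ _ y₃∈D))
  where
  clash : ∀ {a a′} → y₁ ≡ a ⊎ y₁ ≡ a′ → y₂ ≡ a ⊎ y₂ ≡ a′ → y₃ ≡ a ⊎ y₃ ≡ a′ → Empty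
  clash (inj₁ refl) (inj₁ e) _ = y₁≢y₂ (≡-sym e)
  clash (inj₂ refl) (inj₂ e) _ = y₁≢y₂ (≡-sym e)
  clash (inj₁ refl) (inj₂ refl) (inj₁ e) = y₁≢y₃ (≡-sym e)
  clash (inj₁ refl) (inj₂ refl) (inj₂ e) = y₂≢y₃ (≡-sym e)
  clash (inj₂ refl) (inj₁ refl) (inj₁ e) = y₂≢y₃ (≡-sym e)
  clash (inj₂ refl) (inj₁ refl) (inj₂ e) = y₁≢y₃ (≡-sym e)

module StallerStrategies (G : Graph) (C : StarCactus G) where

  open MakerBreaker G
  open StarCactusGeometry G C

  private
    V : Set
    V = Fin (n G)
    _≈_ : V → V → Set
    _≈_ = _~_ G

  module CentreTaken {D S} (legal : Legal D S) (c∈S : c ∈ S) (S⊆c : ∀ u → u ∈ S → u ≡ c) where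

    threat : ∀ {x y} → y ≢ c → y ∉ D → (∀ u → x ≈ u → u ≡ c ⊎ u ≡ y) → StalWins G D S staller
    threat {x} {y} y≢c y∉D nbrs = stalWins-threat x y legal (y∉D , λ y∈S → y≢c (S⊆c y y∈S)) nbrs′
      where
      nbrs′ : ∀ u → x ≈ u → u ∈ S ⊎ u ≡ y
      nbrs′ u x~u with nbrs u x~u
      ... | inj₁ refl = inj₁ c∈S
      ... | inj₂ u≡y = inj₂ u≡y

    K₂-leaf-isolated : ∀ b → L b ≡ 2 → StalWins G D S staller
    K₂-leaf-isolated b L≡2 = stalWins-isolated staller (vertex b 1 1<L) legal λ u x~u →
      subst (_∈ S) (≡-sym (only-centre (first-neighbour (vertex-at b 1 1<L) x~u))) c∈S
      where
      1<L : 1 < L b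
      1<L = subst (1 <_) (≡-sym L≡2) (s≤s (s≤s z≤n))
      only-centre : ∀ {u} → u ≡ c ⊎ At b 2 u → u ≡ c
      only-centre (inj₁ u≡c) = u≡c
      only-centre (inj₂ a) = ⊥-elim (ℕₚ.<-irrefl (≡-sym L≡2) (at-bound a))

    first-threat : ∀ {b y} → At b 2 y → y ∉ D → StalWins G D S staller
    first-threat {b} {y} a y∉D = threat (at-≢0⇒≢centre a (λ ())) y∉D λ u x~u →
      Sum.map₂ (λ a′ → at-functional a′ a) (first-neighbour (vertex-at b 1 1<L) x~u)
      where
      1<L : 1 < L b
      1<L = ℕₚ.<-trans (s≤s (s≤s z≤n)) (at-bound a)

    last-threat : ∀ {b y} → 2 < L b → At b (L b ∸ 2) y → y ∉ D → StalWins G D S staller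
    last-threat {b} 2<L a y∉D = threat (at-≢0⇒≢centre a (L∸2≢0 2<L)) y∉D λ u x~u →
      Sum.map₂ (λ a′ → at-functional a′ a) (last-neighbour (vertex-at b (L b ∸ 1) ℕₚ.≤-refl) x~u)

  staller-first-wins : 2 ≤ k C → StalWins G ⊥ ⊥ staller
  staller-first-wins 2≤k =
    stal-move (¬totalDominating-⊥ c) c (free-start c) (dom-move (¬totalDominating-⊥ c) reply)
    where
    b₀ = proj₁ (two-blocks 2≤k)
    b₁ = proj₁ (proj₂ (two-blocks 2≤k))
    reply : ∀ v → Free {n G} ⊥ (⊥ ∪ ⁅ c ⁆) v → StalWins G (⊥ ∪ ⁅ v ⁆) (⊥ ∪ ⁅ c ⁆) staller
    reply v fr = win (K₂-or-cycle b₀) (K₂-or-cycle b₁)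
      where
      open CentreTaken (legal-dominator (legal-staller legal-start (free-start c)) fr)
                       (∈-∪⁅⁆⁺ ⊥ c) (λ _ → ∈-⊥∪⁅⁆⁻)
      win : L b₀ ≡ 2 ⊎ 2 < L b₀ → L b₁ ≡ 2 ⊎ 2 < L b₁ → StalWins G (⊥ ∪ ⁅ v ⁆) (⊥ ∪ ⁅ c ⁆) staller
      win (inj₁ K₂) _ = K₂-leaf-isolated b₀ K₂
      win (inj₂ _) (inj₁ K₂) = K₂-leaf-isolated b₁ K₂
      win (inj₂ 2<L₀) (inj₂ 2<L₁)
        with avoid-one (at-≢block a₀ a₁ (λ ()) (proj₂ (proj₂ (two-blocks 2≤k)))) (λ _ → ∈-⊥∪⁅⁆⁻)
        where
        a₀ = vertex-at b₀ 2 2<L₀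
        a₁ = vertex-at b₁ 2 2<L₁
      ... | inj₁ y₀∉D = first-threat (vertex-at b₀ 2 2<L₀) y₀∉D
      ... | inj₂ y₁∉D = first-threat (vertex-at b₁ 2 2<L₁) y₁∉D

  staller-wins-off-centre : ∀ {b b′} → b ≢ b′ → 5 ≤ L b → ∀ v → v ≢ c →
                            StalWins G (⊥ ∪ ⁅ v ⁆) ⊥ staller
  staller-wins-off-centre {b} {b′} b≢b′ 5≤L v v≢c =
    stal-move (¬totalDominating-⁅⁆ v) c c-free (dom-move (¬totalDominating-⁅⁆ v) reply)
    where
    c-free : Free {n G} (⊥ ∪ ⁅ v ⁆) ⊥ c
    c-free = (λ c∈ → v≢c (≡-sym (∈-⊥∪⁅⁆⁻ c∈))) , ∉⊥
    2<L : 2 < L b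
    2<L = ℕₚ.<-≤-trans (s≤s (s≤s (s≤s z≤n))) 5≤L
    2≢L∸2 : 2 ≢ L b ∸ 2
    2≢L∸2 eq = ℕₚ.<-irrefl (cong (2 +_) eq) 5≤L
    a₂ = vertex-at b 2 2<L
    a₃ = vertex-at b (L b ∸ 2) (ℕₚ.m≤n⇒m≤1+n (ℕₚ.n<1+n (L b ∸ 2)))
    reply : ∀ v₂ → Free {n G} (⊥ ∪ ⁅ v ⁆) (⊥ ∪ ⁅ c ⁆) v₂ →
            StalWins G ((⊥ ∪ ⁅ v ⁆) ∪ ⁅ v₂ ⁆) (⊥ ∪ ⁅ c ⁆) staller
    reply v₂ fr = win (K₂-or-cycle b′)
      where
      open CentreTaken
        (legal-dominator (legal-staller (legal-dominator legal-start (free-start v)) c-free) fr)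
                       (∈-∪⁅⁆⁺ ⊥ c) (λ _ → ∈-⊥∪⁅⁆⁻)
      D⊆vv₂ : ∀ u → u ∈ (⊥ ∪ ⁅ v ⁆) ∪ ⁅ v₂ ⁆ → u ≡ v ⊎ u ≡ v₂
      D⊆vv₂ u u∈ = Sum.map₁ ∈-⊥∪⁅⁆⁻ (∈-∪⁅⁆⁻ (⊥ ∪ ⁅ v ⁆) v₂ u∈)
      win : L b′ ≡ 2 ⊎ 2 < L b′ → StalWins G ((⊥ ∪ ⁅ v ⁆) ∪ ⁅ v₂ ⁆) (⊥ ∪ ⁅ c ⁆) staller
      win (inj₁ K₂) = K₂-leaf-isolated b′ K₂
      win (inj₂ 2<L′) with avoid-two (at-≢position a₂ a₃ 2≢L∸2) (at-≢block a₂ a′ (λ ()) b≢b′)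
                                     (at-≢block a₃ a′ (L∸2≢0 2<L) b≢b′) D⊆vv₂
        where a′ = vertex-at b′ 2 2<L′
      ... | inj₁ y₂∉D = first-threat a₂ y₂∉D
      ... | inj₂ (inj₁ y₃∉D) = last-threat 2<L a₃ y₃∉D
      ... | inj₂ (inj₂ y′∉D) = first-threat (vertex-at b′ 2 2<L′) y′∉D

  staller-wins-centre-long : ∀ b → 6 ≤ L b → StalWins G (⊥ ∪ ⁅ c ⁆) ⊥ staller
  staller-wins-centre-long b 6≤L =
    stal-move (¬totalDominating-⁅⁆ c) (x (# 3)) x₃-free (dom-move (¬totalDominating-⁅⁆ c) reply)
    where
    x : Fin 6 → V
    x i = vertex b (toℕ i) (ℕₚ.<-≤-trans (Finₚ.toℕ<n i) 6≤L)
    at : ∀ i → At b (toℕ i) (x i)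
    at i = vertex-at b (toℕ i) (ℕₚ.<-≤-trans (Finₚ.toℕ<n i) 6≤L)
    x≢ : ∀ i j → toℕ i ≢ toℕ j → x i ≢ x j
    x≢ i j = at-≢position (at i) (at j)
    not-last : ∀ t → t < 5 → t ≢ L b ∸ 1
    not-last t t<5 eq = ℕₚ.<-irrefl refl (ℕₚ.<-≤-trans (subst (_< 5) eq t<5) (ℕₚ.∸-monoˡ-≤ 1 6≤L))
    x₃-free : Free {n G} (⊥ ∪ ⁅ c ⁆) ⊥ (x (# 3))
    x₃-free = (λ x₃∈ → at-≢0⇒≢centre (at (# 3)) (λ ()) (∈-⊥∪⁅⁆⁻ x₃∈)) , ∉⊥
    x₃∈S : x (# 3) ∈ ⊥ ∪ ⁅ x (# 3) ⁆
    x₃∈S = ∈-∪⁅⁆⁺ ⊥ (x (# 3))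
    legal₁ : Legal (⊥ ∪ ⁅ c ⁆) (⊥ ∪ ⁅ x (# 3) ⁆)
    legal₁ = legal-staller (legal-dominator legal-start (free-start c)) x₃-free
    reply : ∀ u → Free {n G} (⊥ ∪ ⁅ c ⁆) (⊥ ∪ ⁅ x (# 3) ⁆) u →
            StalWins G ((⊥ ∪ ⁅ c ⁆) ∪ ⁅ u ⁆) (⊥ ∪ ⁅ x (# 3) ⁆) staller
    reply u fr with u Finₚ.≟ x (# 1)
    ... | no u≢x₁ = stalWins-threat (x (# 2)) (x (# 1)) (legal-dominator legal₁ fr) (x₁∉D , x₁∉S) nbrs
      where
      x₁∉D : x (# 1) ∉ (⊥ ∪ ⁅ c ⁆) ∪ ⁅ u ⁆
      x₁∉D = ∉-∪⁅⁆ u (λ x₁∈ → at-≢0⇒≢centre (at (# 1)) (λ ()) (∈-⊥∪⁅⁆⁻ x₁∈)) (λ eq → u≢x₁ (≡-sym eq))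
      x₁∉S : x (# 1) ∉ ⊥ ∪ ⁅ x (# 3) ⁆
      x₁∉S x₁∈ = x≢ (# 1) (# 3) (λ ()) (∈-⊥∪⁅⁆⁻ x₁∈)
      nbrs : ∀ v → x (# 2) ≈ v → v ∈ ⊥ ∪ ⁅ x (# 3) ⁆ ⊎ v ≡ x (# 1)
      nbrs v x₂~v with interior-neighbour (at (# 2)) (s≤s z≤n) (not-last 2 (s≤s (s≤s (s≤s z≤n)))) x₂~v
      ... | _ , a , inj₁ refl = inj₁ (subst (_∈ ⊥ ∪ ⁅ x (# 3) ⁆) (at-functional (at (# 3)) a) x₃∈S)
      ... | _ , a , inj₂ refl = inj₂ (at-functional a (at (# 1)))
    ... | yes refl = stalWins-threat (x (# 4)) (x (# 5)) (legal-dominator legal₁ fr) (x₅∉D , x₅∉S) nbrs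
      where
      x₅∉D : x (# 5) ∉ (⊥ ∪ ⁅ c ⁆) ∪ ⁅ x (# 1) ⁆
      x₅∉D = ∉-∪⁅⁆ (x (# 1)) (λ x₅∈ → at-≢0⇒≢centre (at (# 5)) (λ ()) (∈-⊥∪⁅⁆⁻ x₅∈)) (x≢ (# 5) (# 1) (λ ()))
      x₅∉S : x (# 5) ∉ ⊥ ∪ ⁅ x (# 3) ⁆
      x₅∉S x₅∈ = x≢ (# 5) (# 3) (λ ()) (∈-⊥∪⁅⁆⁻ x₅∈)
      nbrs : ∀ v → x (# 4) ≈ v → v ∈ ⊥ ∪ ⁅ x (# 3) ⁆ ⊎ v ≡ x (# 5)
      nbrs v x₄~v with interior-neighbour (at (# 4)) (s≤s z≤n) (not-last 4 ℕₚ.≤-refl) x₄~v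
      ... | _ , a , inj₁ refl = inj₂ (at-functional a (at (# 5)))
      ... | _ , a , inj₂ refl = inj₁ (subst (_∈ ⊥ ∪ ⁅ x (# 3) ⁆) (at-functional (at (# 3)) a) x₃∈S)

  other-block : 2 ≤ k C → ∀ b → ∃[ b′ ] b ≢ b′
  other-block 2≤k b with b Finₚ.≟ proj₁ (two-blocks 2≤k)
  ... | yes refl = proj₁ (proj₂ (two-blocks 2≤k)) , proj₂ (proj₂ (two-blocks 2≤k))
  ... | no b≢b₀ = proj₁ (two-blocks 2≤k) , b≢b₀

  staller-second-wins : 2 ≤ k C → ∀ {b} → 5 ≤ L b → StalWins G (⊥ ∪ ⁅ c ⁆) ⊥ staller →
                        StalWins G ⊥ ⊥ dominator
  staller-second-wins 2≤k {b} 5≤L centre-opening = dom-move (¬totalDominating-⊥ c) opening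
    where
    opening : ∀ v → Free {n G} ⊥ ⊥ v → StalWins G (⊥ ∪ ⁅ v ⁆) ⊥ staller
    opening v _ with v Finₚ.≟ c
    ... | yes refl = centre-opening
    ... | no v≢c = staller-wins-off-centre (proj₂ (other-block 2≤k b)) 5≤L v v≢c

  Inner Outer : Fin (k C) → V → Set
  Inner b u = ∃[ t ] (At b t u × (t ≡ 2 ⊎ t ≡ 3))
  Outer b u = ∃[ t ] (At b t u × (t ≡ 1 ⊎ t ≡ 4))

  centre-undominated : ∀ {D} → (∀ u → u ∈ D → u ≡ c ⊎ ∃[ b ] (L b ≡ 5 × Inner b u)) →
                       ¬ IsTotalDominating G D
  centre-undominated {D} D-inner td with td c
  ... | u , u∈D , c~u with D-inner u u∈D | centre-neighbour c~u
  ...   | inj₁ refl | _ = irrefl G c~u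
  ...   | inj₂ (b , L≡5 , t , a , t∈23) | b′ , t′ , a′ , t′∈1last
          with at-unique a′ a (at-≢centre⇒≢0 a′ λ { refl → irrefl G c~u })
  ...     | refl , refl = outer≢inner L≡5 t′∈1last t∈23
    where
    outer≢inner : ∀ {l s} → l ≡ 5 → s ≡ 1 ⊎ s ≡ l ∸ 1 → s ≡ 2 ⊎ s ≡ 3 → Empty
    outer≢inner refl (inj₁ refl) (inj₁ ())
    outer≢inner refl (inj₁ refl) (inj₂ ())
    outer≢inner refl (inj₂ refl) (inj₁ ())
    outer≢inner refl (inj₂ refl) (inj₂ ())

  module FiveCycles (shape : ∀ b → L b ≡ 2 ⊎ L b ≡ 5)
                    (K₂-unique : ∀ b b′ → L b ≡ 2 → L b′ ≡ 2 → b ≡ b′) where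

    Done : ℕ → Fin (k C) → Set
    Done p b = toℕ b < p × L b ≡ 5

    record Forced (p : ℕ) (D S : Subset (n G)) : Set where
      field
        legal   : Legal D S
        D-inner : ∀ u → u ∈ D → u ≡ c ⊎ ∃[ b ] (Done p b × Inner b u)
        S-outer : ∀ u → u ∈ S → ∃[ b ] (Done p b × Outer b u)
        outer-S : ∀ b → Done p b → ∀ u → Outer b u → u ∈ S
    open Forced

    StallerWinsFrom : ℕ → Set
    StallerWinsFrom p = ∀ {D S} → Forced p D S → StalWins G D S staller

    done-suc : ∀ {p b} → Done p b → Done (suc p) b
    done-suc (b<p , L≡5) = ℕₚ.m<n⇒m<1+n b<p , L≡5

    done-new : ∀ {p b b′} → toℕ b′ ≡ p → Done (suc p) b → Done p b ⊎ b ≡ b′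
    done-new {b = b} {b′} b′≡p (b<1+p , L≡5) with ℕₚ.m<1+n⇒m<n∨m≡n b<1+p
    ... | inj₁ b<p = inj₁ (b<p , L≡5)
    ... | inj₂ b≡p = inj₂ (Finₚ.toℕ-injective (trans b≡p (≡-sym b′≡p)))

    forced-¬totalDominating : ∀ {p D S} → Forced p D S → ¬ IsTotalDominating G D
    forced-¬totalDominating F = centre-undominated λ u u∈D → Sum.map₂
      (λ { (b , (_ , L≡5) , inner) → b , L≡5 , inner }) (D-inner F u u∈D)

    fresh-D : ∀ {p D S b t y} → Forced p D S → ¬ Done p b → At b t y → t ≢ 0 → y ∉ D
    fresh-D F ¬done a t≢0 y∈D with D-inner F _ y∈D
    ... | inj₁ y≡c = at-≢0⇒≢centre a t≢0 y≡c
    ... | inj₂ (b′ , done , t′ , a′ , _) with at-unique a a′ t≢0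
    ...   | refl , _ = ¬done done

    fresh-S : ∀ {p D S b t y} → Forced p D S → ¬ Done p b → At b t y → t ≢ 0 → y ∉ S
    fresh-S F ¬done a t≢0 y∈S with S-outer F _ y∈S
    ... | b′ , done , t′ , a′ , _ with at-unique a a′ t≢0
    ...   | refl , _ = ¬done done

    forced-K₂ : ∀ {p D S b} → toℕ b ≡ p → L b ≡ 2 → Forced p D S → Forced (suc p) D S
    forced-K₂ {b = b} b≡p L≡2 F = record
      { legal   = legal F
      ; D-inner = λ u u∈D →
          Sum.map₂ (λ { (b′ , done , inner) → b′ , done-suc done , inner }) (D-inner F u u∈D)
      ; S-outer = λ u u∈S → let (b′ , done , outer) = S-outer F u u∈S in b′ , done-suc done , outer
      ; outer-S = outer
      }
      where
      outer : ∀ b′ → Done (suc _) b′ → ∀ u → Outer b′ u → u ∈ _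
      outer b′ done u o with done-new b≡p done
      ... | inj₁ done′ = outer-S F b′ done′ u o
      ... | inj₂ refl = ⊥-elim (2≢5 (trans (≡-sym L≡2) (proj₂ done)))
        where
        2≢5 : 2 ≢ 5
        2≢5 ()

    module C₅Step {p D S b} (b≡p : toℕ b ≡ p) (L≡5 : L b ≡ 5) (F : Forced p D S) where

      x : Fin 5 → V
      x i = vertex b (toℕ i) (subst (toℕ i <_) (≡-sym L≡5) (Finₚ.toℕ<n i))

      at : ∀ i → At b (toℕ i) (x i)
      at i = vertex-at b (toℕ i) (subst (toℕ i <_) (≡-sym L≡5) (Finₚ.toℕ<n i))

      x≢ : ∀ i j → toℕ i ≢ toℕ j → x i ≢ x j
      x≢ i j = at-≢position (at i) (at j)

      fresh : ∀ i → toℕ i ≢ 0 → Free {n G} D S (x i)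
      fresh i i≢0 = fresh-D F ¬done (at i) i≢0 , fresh-S F ¬done (at i) i≢0
        where
        ¬done : ¬ Done p b
        ¬done (b<p , _) = ℕₚ.<-irrefl b≡p b<p

      neighbours : ∀ i → toℕ i ≡ 2 ⊎ toℕ i ≡ 3 → ∀ {u} → x i ≈ u →
                   ∃[ t ] (At b t u × (t ≡ suc (toℕ i) ⊎ suc t ≡ toℕ i))
      neighbours i i∈23 = interior-neighbour (at i) (0<i i∈23) (not-last i∈23)
        where
        0<i : toℕ i ≡ 2 ⊎ toℕ i ≡ 3 → 0 < toℕ i
        0<i (inj₁ eq) = subst (0 <_) (≡-sym eq) (s≤s z≤n)
        0<i (inj₂ eq) = subst (0 <_) (≡-sym eq) (s≤s z≤n)
        not-last : toℕ i ≡ 2 ⊎ toℕ i ≡ 3 → toℕ i ≢ L b ∸ 1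
        not-last (inj₁ eq) eq′ with trans (≡-sym eq) (trans eq′ (cong (_∸ 1) L≡5))
        ... | ()
        not-last (inj₂ eq) eq′ with trans (≡-sym eq) (trans eq′ (cong (_∸ 1) L≡5))
        ... | ()

      D₁ S₁ D₂ S₂ : Subset (n G)
      D₁ = D ∪ ⁅ x (# 3) ⁆
      S₁ = S ∪ ⁅ x (# 1) ⁆
      D₂ = D₁ ∪ ⁅ x (# 2) ⁆
      S₂ = S₁ ∪ ⁅ x (# 4) ⁆

      forced-next : Legal D₂ S₂ → Forced (suc p) D₂ S₂
      forced-next l = record { legal = l ; D-inner = D₂-inner ; S-outer = S₂-outer ; outer-S = outer-S₂ }
        where
        done : Done (suc p) b
        done = subst (_< suc p) (≡-sym b≡p) (ℕₚ.n<1+n p) , L≡5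
        D₂-inner : ∀ u → u ∈ D₂ → u ≡ c ⊎ ∃[ b′ ] (Done (suc p) b′ × Inner b′ u)
        D₂-inner u u∈ with ∈-∪⁅⁆∪⁅⁆⁻ D (x (# 3)) (x (# 2)) u∈
        ... | inj₁ u∈D = Sum.map₂ (λ { (b′ , d , inner) → b′ , done-suc d , inner }) (D-inner F u u∈D)
        ... | inj₂ (inj₁ refl) = inj₂ (b , done , 3 , at (# 3) , inj₂ refl)
        ... | inj₂ (inj₂ refl) = inj₂ (b , done , 2 , at (# 2) , inj₁ refl)
        S₂-outer : ∀ u → u ∈ S₂ → ∃[ b′ ] (Done (suc p) b′ × Outer b′ u)
        S₂-outer u u∈ with ∈-∪⁅⁆∪⁅⁆⁻ S (x (# 1)) (x (# 4)) u∈
        ... | inj₁ u∈S = let (b′ , d , outer) = S-outer F u u∈S in b′ , done-suc d , outer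
        ... | inj₂ (inj₁ refl) = b , done , 1 , at (# 1) , inj₁ refl
        ... | inj₂ (inj₂ refl) = b , done , 4 , at (# 4) , inj₂ refl
        outer-S₂ : ∀ b′ → Done (suc p) b′ → ∀ u → Outer b′ u → u ∈ S₂
        outer-S₂ b′ d u o with done-new b≡p d
        ... | inj₁ d′ = p⊆p∪q ⁅ x (# 4) ⁆ (p⊆p∪q ⁅ x (# 1) ⁆ (outer-S F b′ d′ u o))
        ... | inj₂ refl with o
        ...   | 1 , a , inj₁ refl =
          p⊆p∪q ⁅ x (# 4) ⁆ (subst (_∈ S₁) (at-functional (at (# 1)) a) (∈-∪⁅⁆⁺ S (x (# 1))))
        ...   | 4 , a , inj₂ refl = subst (_∈ S₂) (at-functional (at (# 4)) a) (∈-∪⁅⁆⁺ S₁ (x (# 4)))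

      legal₁ : Legal D S₁
      legal₁ = legal-staller (legal F) (fresh (# 1) (λ ()))

      ¬totalDominating₁ : ¬ IsTotalDominating G D₁
      ¬totalDominating₁ = centre-undominated λ u u∈ → case (∈-∪⁅⁆⁻ D (x (# 3)) u∈)
        where
        case : ∀ {u} → u ∈ D ⊎ u ≡ x (# 3) → u ≡ c ⊎ ∃[ b′ ] (L b′ ≡ 5 × Inner b′ u)
        case (inj₁ u∈D) = Sum.map₂ (λ { (b′ , (_ , L≡5′) , inner) → b′ , L≡5′ , inner }) (D-inner F _ u∈D)
        case (inj₂ refl) = inj₂ (b , L≡5 , 3 , at (# 3) , inj₂ refl)

      x₃∉D : x (# 3) ∉ D
      x₃∉D = proj₁ (fresh (# 3) (λ ()))
      x₃∉S₁ : x (# 3) ∉ S₁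
      x₃∉S₁ = ∉-∪⁅⁆ (x (# 1)) (proj₂ (fresh (# 3) (λ ()))) (x≢ (# 3) (# 1) (λ ()))
      x₄-free : Free {n G} D₁ S₁ (x (# 4))
      x₄-free = ∉-∪⁅⁆ (x (# 3)) (proj₁ (fresh (# 4) (λ ()))) (x≢ (# 4) (# 3) (λ ())) ,
                ∉-∪⁅⁆ (x (# 1)) (proj₂ (fresh (# 4) (λ ()))) (x≢ (# 4) (# 1) (λ ()))
      legal₂ : Legal D₁ S₂
      legal₂ = legal-staller (legal-dominator legal₁ (x₃∉D , x₃∉S₁)) x₄-free

      second-reply : StallerWinsFrom (suc p) →
                     ∀ u → Free {n G} D₁ S₂ u → StalWins G (D₁ ∪ ⁅ u ⁆) S₂ staller
      second-reply continue u fr with u Finₚ.≟ x (# 2)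
      ... | yes refl = continue (forced-next (legal-dominator legal₂ fr))
      ... | no u≢x₂ = stalWins-threat (x (# 3)) (x (# 2)) (legal-dominator legal₂ fr) (x₂∉D , x₂∉S) nbrs
        where
        x₂∉D : x (# 2) ∉ D₁ ∪ ⁅ u ⁆
        x₂∉D = ∉-∪⁅⁆ u (∉-∪⁅⁆ (x (# 3)) (proj₁ (fresh (# 2) (λ ()))) (x≢ (# 2) (# 3) (λ ())))
                      (λ eq → u≢x₂ (≡-sym eq))
        x₂∉S : x (# 2) ∉ S₂
        x₂∉S = ∉-∪⁅⁆ (x (# 4)) (∉-∪⁅⁆ (x (# 1)) (proj₂ (fresh (# 2) (λ ()))) (x≢ (# 2) (# 1) (λ ())))
                             (x≢ (# 2) (# 4) (λ ()))
        nbrs : ∀ v → x (# 3) ≈ v → v ∈ S₂ ⊎ v ≡ x (# 2)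
        nbrs v x₃~v with neighbours (# 3) (inj₂ refl) x₃~v
        ... | _ , a , inj₁ refl = inj₁ (subst (_∈ S₂) (at-functional (at (# 4)) a) (∈-∪⁅⁆⁺ S₁ (x (# 4))))
        ... | _ , a , inj₂ refl = inj₂ (at-functional a (at (# 2)))

      first-reply : StallerWinsFrom (suc p) →
                    ∀ u → Free {n G} D S₁ u → StalWins G (D ∪ ⁅ u ⁆) S₁ staller
      first-reply continue u fr with u Finₚ.≟ x (# 3)
      ... | yes refl = stal-move ¬totalDominating₁ (x (# 4)) x₄-free
                         (dom-move ¬totalDominating₁ (second-reply continue))
      ... | no u≢x₃ = stalWins-threat (x (# 2)) (x (# 3)) (legal-dominator legal₁ fr)
                        (∉-∪⁅⁆ u x₃∉D (λ eq → u≢x₃ (≡-sym eq)) , x₃∉S₁) nbrs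
        where
        nbrs : ∀ v → x (# 2) ≈ v → v ∈ S₁ ⊎ v ≡ x (# 3)
        nbrs v x₂~v with neighbours (# 2) (inj₁ refl) x₂~v
        ... | _ , a , inj₁ refl = inj₂ (at-functional a (at (# 3)))
        ... | _ , a , inj₂ refl = inj₁ (subst (_∈ S₁) (at-functional (at (# 1)) a) (∈-∪⁅⁆⁺ S (x (# 1))))

      forced-C₅ : StallerWinsFrom (suc p) → StalWins G D S staller
      forced-C₅ continue = stal-move ¬td (x (# 1)) (fresh (# 1) (λ ())) (dom-move ¬td (first-reply continue))
        where ¬td = forced-¬totalDominating F

    open C₅Step using (forced-C₅)

    centre-neighbour-forced : ∀ {D S} → Forced (k C) D S → ∀ {u} → c ≈ u → u ∈ S ⊎ ∃[ b ] (L b ≡ 2 × At b 1 u)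
    centre-neighbour-forced F {u} c~u with centre-neighbour c~u
    ... | b , t , a , t∈1last with shape b | t∈1last
    ...   | inj₁ L≡2 | inj₁ refl = inj₂ (b , L≡2 , a)
    ...   | inj₁ L≡2 | inj₂ refl = inj₂ (b , L≡2 , subst (λ s → At b s u) (cong (_∸ 1) L≡2) a)
    ...   | inj₂ L≡5 | inj₁ refl = inj₁ (outer-S F b (Finₚ.toℕ<n b , L≡5) u (1 , a , inj₁ refl))
    ...   | inj₂ L≡5 | inj₂ refl =
      inj₁ (outer-S F b (Finₚ.toℕ<n b , L≡5) u (L b ∸ 1 , a , inj₂ (cong (_∸ 1) L≡5)))

    forced-all : StallerWinsFrom (k C)
    forced-all {D} {S} F with Finₚ.any? (λ b → L b ℕ.≟ 2)
    ... | no no-K₂ = stalWins-isolated staller c (legal F) λ u c~u → only-S (centre-neighbour-forced F c~u)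
      where
      only-S : ∀ {u} → u ∈ S ⊎ ∃[ b ] (L b ≡ 2 × At b 1 u) → u ∈ S
      only-S (inj₁ u∈S) = u∈S
      only-S (inj₂ (b , L≡2 , _)) = ⊥-elim (no-K₂ (b , L≡2))
    ... | yes (b , L≡2) =
      stalWins-threat c ℓ (legal F) (fresh-D F ¬done a (λ ()) , fresh-S F ¬done a (λ ())) nbrs
      where
      ℓ = vertex b 1 (subst (1 <_) (≡-sym L≡2) (s≤s (s≤s z≤n)))
      a = vertex-at b 1 (subst (1 <_) (≡-sym L≡2) (s≤s (s≤s z≤n)))
      ¬done : ¬ Done (k C) b
      ¬done (_ , L≡5) with trans (≡-sym L≡2) L≡5
      ... | ()
      nbrs : ∀ u → c ≈ u → u ∈ S ⊎ u ≡ ℓ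
      nbrs u c~u with centre-neighbour-forced F c~u
      ... | inj₁ u∈S = inj₁ u∈S
      ... | inj₂ (b′ , L′≡2 , a′) with K₂-unique b′ b L′≡2 L≡2
      ...   | refl = inj₂ (at-functional a′ a)

    forced-from : ∀ d p → p + d ≡ k C → StallerWinsFrom p
    forced-from zero p p+0≡k {D} {S} F =
      forced-all (subst (λ q → Forced q D S) (trans (≡-sym (ℕₚ.+-identityʳ p)) p+0≡k) F)
    forced-from (suc d) p p+d≡k = by-shape (shape (fromℕ< p<k))
      where
      p<k : p < k C
      p<k = subst (p <_) p+d≡k (ℕₚ.m<m+n p (s≤s z≤n))
      rest : StallerWinsFrom (suc p)
      rest = forced-from d (suc p) (trans (≡-sym (ℕₚ.+-suc p d)) p+d≡k)
      by-shape : L (fromℕ< p<k) ≡ 2 ⊎ L (fromℕ< p<k) ≡ 5 → StallerWinsFrom p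
      by-shape (inj₁ L≡2) F = rest (forced-K₂ (Finₚ.toℕ-fromℕ< p<k) L≡2 F)
      by-shape (inj₂ L≡5) F = forced-C₅ (Finₚ.toℕ-fromℕ< p<k) L≡5 F rest

    centre-opening : StalWins G (⊥ ∪ ⁅ c ⁆) ⊥ staller
    centre-opening = forced-from (k C) 0 refl (record
      { legal   = legal-dominator legal-start (free-start c)
      ; D-inner = λ u u∈ → inj₁ (∈-⊥∪⁅⁆⁻ u∈)
      ; S-outer = λ u u∈⊥ → ⊥-elim (∉⊥ u∈⊥)
      ; outer-S = λ b (b<0 , _) → ⊥-elim (ℕₚ.n≮0 b<0)
      })

    staller-wins-five-cycles : 2 ≤ k C → StalWins G ⊥ ⊥ dominator
    staller-wins-five-cycles 2≤k with shape b₀ | shape b₁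
      where
      b₀ = proj₁ (two-blocks 2≤k)
      b₁ = proj₁ (proj₂ (two-blocks 2≤k))
    ... | inj₂ L≡5 | _ = staller-second-wins 2≤k (ℕₚ.≤-reflexive (≡-sym L≡5)) centre-opening
    ... | _ | inj₂ L≡5 = staller-second-wins 2≤k (ℕₚ.≤-reflexive (≡-sym L≡5)) centre-opening
    ... | inj₁ L₀≡2 | inj₁ L₁≡2 = ⊥-elim (proj₂ (proj₂ (two-blocks 2≤k)) (K₂-unique _ _ L₀≡2 L₁≡2))

-- Dominator's pairing of the positions 1, …, l ∸ 1 of a block of length l ≤ 5 (position 0 is the
-- centre); unlisted positions, in particular a K₂ leaf, are their own mates.
cycle-mate : ℕ → ℕ → ℕ
cycle-mate 3 1 = 2
cycle-mate 3 2 = 1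
cycle-mate 4 1 = 3
cycle-mate 4 3 = 1
cycle-mate 5 1 = 3
cycle-mate 5 3 = 1
cycle-mate 5 2 = 4
cycle-mate 5 4 = 2
cycle-mate _ t = t

cycle-mate-valid : ∀ {l} → l < 6 → ∀ {t} → t < l → 0 < t →
                   0 < cycle-mate l t × cycle-mate l t < l × cycle-mate l (cycle-mate l t) ≡ t
cycle-mate-valid = from-yes (ℕₚ.allUpTo? (λ l → ℕₚ.allUpTo? (λ t → 0 ℕ.<? t →-dec
  (0 ℕ.<? cycle-mate l t ×-dec cycle-mate l t ℕ.<? l ×-dec cycle-mate l (cycle-mate l t) ℕ.≟ t)) l) 6)

cycle-mate-skip : ∀ {l} → l < 6 → ∀ {s} → s < l → 0 < s → suc (suc s) < l → cycle-mate l s ≡ suc (suc s)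
cycle-mate-skip = from-yes (ℕₚ.allUpTo? (λ l → ℕₚ.allUpTo? (λ s → 0 ℕ.<? s →-dec
  (suc (suc s) ℕ.<? l →-dec cycle-mate l s ℕ.≟ suc (suc s))) l) 6)

cycle-mate-centre : ∀ {l} → l ≡ 3 ⊎ l ≡ 4 → cycle-mate l 1 ≡ l ∸ 1
cycle-mate-centre (inj₁ refl) = refl
cycle-mate-centre (inj₂ refl) = refl

swap : ∀ {m} → Fin m → Fin m → Fin m → Fin m
swap i j x with x Finₚ.≟ i | x Finₚ.≟ j
... | yes _ | _ = j
... | no _ | yes _ = i
... | no _ | no _ = x

module _ {m} (i j : Fin m) where

  swap-left : swap i j i ≡ j
  swap-left with i Finₚ.≟ i
  ... | yes _ = refl
  ... | no i≢i = ⊥-elim (i≢i refl)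

  swap-right : swap i j j ≡ i
  swap-right with j Finₚ.≟ i | j Finₚ.≟ j
  ... | yes j≡i | _ = j≡i
  ... | no _ | yes _ = refl
  ... | no _ | no j≢j = ⊥-elim (j≢j refl)

  swap-other : ∀ {x} → x ≢ i → x ≢ j → swap i j x ≡ x
  swap-other {x} x≢i x≢j with x Finₚ.≟ i | x Finₚ.≟ j
  ... | yes x≡i | _ = ⊥-elim (x≢i x≡i)
  ... | no _ | yes x≡j = ⊥-elim (x≢j x≡j)
  ... | no _ | no _ = refl

  swap-involutive : ∀ x → swap i j (swap i j x) ≡ x
  swap-involutive x with x Finₚ.≟ i | x Finₚ.≟ j
  ... | yes refl | _ = swap-right
  ... | no _ | yes refl = swap-left
  ... | no x≢i | no x≢j = swap-other x≢i x≢j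

  swap-respects : ∀ {A : Set} (f : Fin m → A) → f i ≡ f j → ∀ x → f (swap i j x) ≡ f x
  swap-respects f fi≡fj x with x Finₚ.≟ i | x Finₚ.≟ j
  ... | yes refl | _ = ≡-sym fi≡fj
  ... | no _ | yes refl = fi≡fj
  ... | no _ | no _ = refl

swap-same : ∀ {m} (i x : Fin m) → swap i i x ≡ x
swap-same i x with x Finₚ.≟ i
... | yes x≡i = ≡-sym x≡i
... | no _ = refl

module DominatorPairing (G : Graph) (C : StarCactus G) where

  open MakerBreaker G
  open StarCactusGeometry G C

  private
    V : Set
    V = Fin (n G)
    _≈_ : V → V → Set
    _≈_ = _~_ G

  -- σ fixes the centre, pairs positions inside each block by cycle-mate, and, when k₁ ≢ k₂, pairs
  -- the leaves of the K₂ blocks k₁ and k₂ with each other.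
  module Pairs (short : ∀ b → L b ≤ 5) (k₁ k₂ : Fin (k C)) (swappable : k₁ ≡ k₂ ⊎ (L k₁ ≡ 2 × L k₂ ≡ 2)) where

    τ : Fin (k C) → Fin (k C)
    τ = swap k₁ k₂

    L-τ : ∀ b → L (τ b) ≡ L b
    L-τ = swap-respects k₁ k₂ L (same-length swappable)
      where
      same-length : ∀ {i j} → i ≡ j ⊎ (L i ≡ 2 × L j ≡ 2) → L i ≡ L j
      same-length (inj₁ refl) = refl
      same-length (inj₂ (Li≡2 , Lj≡2)) = trans Li≡2 (≡-sym Lj≡2)

    τ-cycle : ∀ b → L b ≢ 2 → τ b ≡ b
    τ-cycle b = fixes swappable
      where
      fixes : ∀ {i j} → i ≡ j ⊎ (L i ≡ 2 × L j ≡ 2) → L b ≢ 2 → swap i j b ≡ b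
      fixes {i} (inj₁ refl) _ = swap-same i b
      fixes {i} {j} (inj₂ (Li≡2 , Lj≡2)) L≢2 = swap-other i j (λ { refl → L≢2 Li≡2 }) (λ { refl → L≢2 Lj≡2 })

    mate-valid : ∀ {b t} → t < L b → t ≢ 0 →
                 0 < cycle-mate (L b) t × cycle-mate (L b) t < L b × cycle-mate (L b) (cycle-mate (L b) t) ≡ t
    mate-valid {b} t<L t≢0 = cycle-mate-valid (s≤s (short b)) t<L (ℕₚ.n≢0⇒n>0 t≢0)

    mate-bound : ∀ {b t u} → At b t u → u ≢ c → cycle-mate (L b) t < L (τ b)
    mate-bound {b} {t} a u≢c = subst (cycle-mate (L b) t <_) (≡-sym (L-τ b))
      (proj₁ (proj₂ (mate-valid (at-bound a) (at-≢centre⇒≢0 a u≢c))))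

    σ : V → V
    σ u with u Finₚ.≟ c | home u
    ... | yes _ | _ = u
    ... | no u≢c | b , t , a = vertex (τ b) (cycle-mate (L b) t) (mate-bound a u≢c)

    σ-centre : σ c ≡ c
    σ-centre with c Finₚ.≟ c
    ... | yes _ = refl
    ... | no c≢c = ⊥-elim (c≢c refl)

    σ-at : ∀ {b t u} → At b t u → t ≢ 0 → At (τ b) (cycle-mate (L b) t) (σ u)
    σ-at {u = u} a t≢0 with u Finₚ.≟ c | home u
    ... | yes u≡c | _ = ⊥-elim (at-≢0⇒≢centre a t≢0 u≡c)
    ... | no u≢c | b′ , t′ , a′ with at-unique a′ a (at-≢centre⇒≢0 a′ u≢c)
    ...   | refl , refl = vertex-at (τ b′) (cycle-mate (L b′) t′) (mate-bound a′ u≢c)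

    σ-involutive : ∀ u → σ (σ u) ≡ u
    σ-involutive u = by-cases (u Finₚ.≟ c)
      where
      by-cases : Dec (u ≡ c) → σ (σ u) ≡ u
      by-cases (yes refl) = trans (cong σ σ-centre) σ-centre
      by-cases (no u≢c) =
        at-functional (subst₂ (λ b′ t′ → At b′ t′ (σ (σ u))) (swap-involutive k₁ k₂ b) back (σ-at a₁ m≢0)) a
        where
        b = proj₁ (home u)
        t = proj₁ (proj₂ (home u))
        a = proj₂ (proj₂ (home u))
        t≢0 = at-≢centre⇒≢0 a u≢c
        a₁ = σ-at a t≢0
        m≢0 : cycle-mate (L b) t ≢ 0
        m≢0 eq = ℕₚ.<⇒≢ (proj₁ (mate-valid (at-bound a) t≢0)) (≡-sym eq)
        back : cycle-mate (L (τ b)) (cycle-mate (L b) t) ≡ t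
        back = trans (cong (λ l → cycle-mate l (cycle-mate (L b) t)) (L-τ b))
                     (proj₂ (proj₂ (mate-valid (at-bound a) t≢0)))

    open Pairing σ σ-involutive

    pair-neighbour : ∀ {D} → Covers D → ∀ {x u} → σ u ≢ u → x ≈ u → x ≈ σ u → ∃[ v ] (v ∈ D × x ≈ v)
    pair-neighbour cover {u = u} σu≢u x~u x~σu with cover u σu≢u
    ... | inj₁ u∈D = u , u∈D , x~u
    ... | inj₂ σu∈D = σ u , σu∈D , x~σu

    off-centre-dominated : ∀ {D} → c ∈ D → Covers D → ∀ {x} → x ≢ c → ∃[ v ] (v ∈ D × x ≈ v)
    off-centre-dominated c∈D cover {x} x≢c with home x
    ... | b , zero , a = ⊥-elim (x≢c (at-0⇒centre a))
    ... | b , suc s , a with s ℕ.≟ 0 | suc s ℕ.≟ L b ∸ 1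
    ...   | yes refl | _ = c , c∈D , at-adjacent a (centre-at-0 b) (inj₂ (inj₁ refl))
    ...   | no _ | yes last = c , c∈D , at-adjacent a (centre-at-0 b) (inj₁ (inj₂ (last , refl)))
    ...   | no s≢0 | no not-last = pair-neighbour cover σu≢u
            (at-adjacent a aᵤ (inj₂ (inj₁ refl))) (at-adjacent a aσᵤ (inj₁ (inj₁ refl)))
      where
      s+2<L : suc (suc s) < L b
      s+2<L = ℕₚ.≤∧≢⇒< (at-bound a) λ eq → not-last (cong (_∸ 1) eq)
      s<L : s < L b
      s<L = ℕₚ.<-trans (ℕₚ.n<1+n s) (ℕₚ.<-trans (ℕₚ.n<1+n (suc s)) s+2<L)
      aᵤ = vertex-at b s s<L
      L≢2 : L b ≢ 2
      L≢2 eq with subst (suc (suc s) <_) eq s+2<L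
      ... | s≤s (s≤s ())
      aσᵤ : At b (suc (suc s)) (σ (vertex b s s<L))
      aσᵤ = subst₂ (λ b′ t′ → At b′ t′ (σ (vertex b s s<L))) (τ-cycle b L≢2)
              (cycle-mate-skip (s≤s (short b)) s<L (ℕₚ.n≢0⇒n>0 s≢0) s+2<L) (σ-at aᵤ s≢0)
      σu≢u : σ (vertex b s s<L) ≢ vertex b s s<L
      σu≢u = at-≢position aσᵤ aᵤ (λ eq → ℕₚ.<-irrefl (≡-sym eq) (ℕₚ.<-trans (ℕₚ.n<1+n s) (ℕₚ.n<1+n (suc s))))

    dominator-wins : ∀ {u} → σ u ≢ u → c ≈ u → c ≈ σ u → DomWins G ⊥ ⊥ dominator
    dominator-wins σu≢u c~u c~σu =
      dom-move c (free-start c)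
        (domWins-pairing (⊥ ∪ ⁅ c ⁆) win staller (legal-dominator legal-start (free-start c)) (λ x∈ → x∈)
          λ _ _ → inj₂ (inj₂ (∉⊥ , ∉⊥)))
      where
      win : ∀ D → ⊥ ∪ ⁅ c ⁆ ⊆ D → Covers D → IsTotalDominating G D
      win D c⊆D cover x with x Finₚ.≟ c
      ... | yes refl = pair-neighbour cover σu≢u c~u c~σu
      ... | no x≢c = off-centre-dominated (c⊆D (∈-∪⁅⁆⁺ ⊥ c)) cover x≢c

  dominator-wins-short-cycle : (∀ b → L b ≤ 5) → ∀ b → L b ≡ 3 ⊎ L b ≡ 4 → DomWins G ⊥ ⊥ dominator
  dominator-wins-short-cycle short b L≡3∨4 =
    dominator-wins σx₁≢x₁ (at-adjacent (centre-at-0 b) a₁ (inj₁ (inj₁ refl)))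
      (at-adjacent (centre-at-0 b) aσ (inj₂ (inj₂ (refl , refl))))
    where
    open Pairs short b b (inj₁ refl)
    x₁ : V
    x₁ = vertex b 1 (s≤s (s≤s z≤n))
    a₁ = vertex-at b 1 (s≤s (s≤s z≤n))
    aσ : At b (L b ∸ 1) (σ x₁)
    aσ = subst₂ (λ b′ t′ → At b′ t′ (σ x₁)) (swap-same b b) (cycle-mate-centre L≡3∨4) (σ-at a₁ (λ ()))
    σx₁≢x₁ : σ x₁ ≢ x₁
    σx₁≢x₁ = at-≢position aσ a₁ (last≢1 L≡3∨4)
      where
      last≢1 : L b ≡ 3 ⊎ L b ≡ 4 → L b ∸ 1 ≢ 1
      last≢1 (inj₁ L≡3) eq with trans (≡-sym (cong (_∸ 1) L≡3)) eq
      ... | ()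
      last≢1 (inj₂ L≡4) eq with trans (≡-sym (cong (_∸ 1) L≡4)) eq
      ... | ()

  dominator-wins-two-K₂ : (∀ b → L b ≤ 5) → ∀ {b b′} → b ≢ b′ → L b ≡ 2 → L b′ ≡ 2 → DomWins G ⊥ ⊥ dominator
  dominator-wins-two-K₂ short {b} {b′} b≢b′ L≡2 L′≡2 =
    dominator-wins σu≢u (at-adjacent (centre-at-0 b) a₁ (inj₁ (inj₁ refl)))
      (at-adjacent (centre-at-0 b′) aσ (inj₁ (inj₁ refl)))
    where
    open Pairs short b b′ (inj₂ (L≡2 , L′≡2))
    1<L : 1 < L b
    1<L = subst (1 <_) (≡-sym L≡2) (s≤s (s≤s z≤n))
    a₁ = vertex-at b 1 1<L
    aσ : At b′ 1 (σ (vertex b 1 1<L))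
    aσ = subst₂ (λ b″ t′ → At b″ t′ (σ (vertex b 1 1<L))) (swap-left b b′) (cong (λ l → cycle-mate l 1) L≡2)
           (σ-at a₁ (λ ()))
    σu≢u : σ (vertex b 1 1<L) ≢ vertex b 1 1<L
    σu≢u = at-≢block aσ a₁ (λ ()) (λ eq → b≢b′ (≡-sym eq))

module Classification (G : Graph) (C : StarCactus G) (2≤k : 2 ≤ k C) where

  open MakerBreaker G
  open StarCactusGeometry G C
  open StallerStrategies G C
  open DominatorPairing G C

  blocks≤5⇒cycles≤5 : (∀ b → L b ≤ 5) → AllCyclesAtMost G 5
  blocks≤5⇒cycles≤5 short m f cyc with cycle-length≤block cyc
  ... | b , m≤L = ℕₚ.≤-trans m≤L (short b)

  cycles≤5⇒blocks≤5 : AllCyclesAtMost G 5 → ∀ b → L b ≤ 5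
  cycles≤5⇒blocks≤5 cycles≤5 b with K₂-or-cycle b
  ... | inj₁ L≡2 = subst (_≤ 5) (≡-sym L≡2) (s≤s (s≤s z≤n))
  ... | inj₂ 2<L = cycles≤5 (L b) (w b) (block-cycle b 2<L)

  block-has-cycle : ∀ b {l} → L b ≡ l → 3 ≤ l → HasCycleOfLength G l
  block-has-cycle b refl 3≤L = w b , block-cycle b 3≤L

  short-block⇒good : (∀ b → L b ≤ 5) → ∀ b → L b ≡ 3 ⊎ L b ≡ 4 → GoodCondition G C
  short-block⇒good short b (inj₁ L≡3) = blocks≤5⇒cycles≤5 short , inj₁ (block-has-cycle b L≡3 ℕₚ.≤-refl)
  short-block⇒good short b (inj₂ L≡4) =
    blocks≤5⇒cycles≤5 short , inj₂ (inj₁ (block-has-cycle b L≡4 (ℕₚ.n≤1+n 3)))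

  good⇒dominator-wins : GoodCondition G C → DomWins G ⊥ ⊥ dominator
  good⇒dominator-wins (cycles≤5 , triangle-square-or-K₂s) = by-cases triangle-square-or-K₂s
    where
    short = cycles≤5⇒blocks≤5 cycles≤5
    short-block-wins : ∃[ b ] (L b ≡ 3 ⊎ L b ≡ 4) → DomWins G ⊥ ⊥ dominator
    short-block-wins (b , L≡3∨4) = dominator-wins-short-cycle short b L≡3∨4
    by-cases : HasCycleOfLength G 3 ⊎ HasCycleOfLength G 4 ⊎ TwoK₂Blocks C → DomWins G ⊥ ⊥ dominator
    by-cases (inj₁ triangle) = short-block-wins (short-cycle⇒short-block short (inj₁ refl) triangle)
    by-cases (inj₂ (inj₁ square)) = short-block-wins (short-cycle⇒short-block short (inj₂ refl) square)
    by-cases (inj₂ (inj₂ (b , b′ , b≢b′ , L≡2 , L′≡2))) = dominator-wins-two-K₂ short b≢b′ L≡2 L′≡2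

  bounded-good-or-staller-wins : (∀ b → L b ≤ 5) → GoodCondition G C ⊎ StalWins G ⊥ ⊥ dominator
  bounded-good-or-staller-wins short
    with Finₚ.any? (λ b → (L b ℕ.≟ 3) ⊎-dec (L b ℕ.≟ 4))
       | Finₚ.any? (λ b → Finₚ.any? (λ b′ → ¬? (b Finₚ.≟ b′) ×-dec (L b ℕ.≟ 2) ×-dec (L b′ ℕ.≟ 2)))
  ... | yes (b , L≡3∨4) | _ = inj₁ (short-block⇒good short b L≡3∨4)
  ... | no _ | yes two-K₂ = inj₁ (blocks≤5⇒cycles≤5 short , inj₂ (inj₂ two-K₂))
  ... | no no-short | no no-two = inj₂ (FiveCycles.staller-wins-five-cycles shape K₂-unique 2≤k)
    where
    shape : ∀ b → L b ≡ 2 ⊎ L b ≡ 5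
    shape b with K₂-or-cycle b
    ... | inj₁ L≡2 = inj₁ L≡2
    ... | inj₂ 2<L with 3≤l≤5⇒l≡3∨4∨5 2<L (short b)
    ...   | inj₁ L≡3 = ⊥-elim (no-short (b , inj₁ L≡3))
    ...   | inj₂ (inj₁ L≡4) = ⊥-elim (no-short (b , inj₂ L≡4))
    ...   | inj₂ (inj₂ L≡5) = inj₂ L≡5
    K₂-unique : ∀ b b′ → L b ≡ 2 → L b′ ≡ 2 → b ≡ b′
    K₂-unique b b′ L≡2 L′≡2 with b Finₚ.≟ b′
    ... | yes b≡b′ = b≡b′
    ... | no b≢b′ = ⊥-elim (no-two (b , b′ , b≢b′ , L≡2 , L′≡2))

  good-or-staller-wins : GoodCondition G C ⊎ StalWins G ⊥ ⊥ dominator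
  good-or-staller-wins with Finₚ.any? (λ b → 6 ℕ.≤? L b)
  ... | yes (b , 6≤L) =
    inj₂ (staller-second-wins 2≤k (ℕₚ.≤-trans (ℕₚ.n≤1+n 5) 6≤L) (staller-wins-centre-long b 6≤L))
  ... | no no-long = bounded-good-or-staller-wins λ b → ℕₚ.≤-pred (ℕₚ.≰⇒> λ 6≤L → no-long (b , 6≤L))

lemma5p1 : (G : Graph) (C : StarCactus G) → 2 ≤ k C →
    (IsN G ⇔ GoodCondition G C) × (¬ GoodCondition G C → IsS G)
lemma5p1 G C 2≤k =
  mk⇔ N⇒good (λ good → good⇒dominator-wins good , staller-first-wins 2≤k) ,
  λ ¬good → ¬good⇒staller-wins ¬good , staller-first-wins 2≤k
  where
  open MakerBreaker G
  open StallerStrategies G C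
  open Classification G C 2≤k
  N⇒good : IsN G → GoodCondition G C
  N⇒good (dominator-first , _) with good-or-staller-wins
  ... | inj₁ good = good
  ... | inj₂ staller-wins = ⊥-elim (domWins⇒¬stalWins dominator-first staller-wins)
  ¬good⇒staller-wins : ¬ GoodCondition G C → StalWins G ⊥ ⊥ dominator
  ¬good⇒staller-wins ¬good with good-or-staller-wins
  ... | inj₁ good = ⊥-elim (¬good good)
  ... | inj₂ staller-wins = staller-wins
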